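{- Let $a,b$ be coprime integers with $1\le a\le b$, and write the numerator of the Markov polynomial $M_{a/b}$ as $P_{a/b}(u,v,w)=\sum_{i,j\ge0}A_{ij}u^iv^jw^{a+b-1-i-j}$. Then the Newton polygon $\Delta_{a/b}=\mathrm{Conv}\{(i,j)\in\mathbb{Z}^2: A_{ij}\ne0\}\subset\mathbb{R}^2$ equals the region $$\Big\{(i,j)\in\mathbb{R}^2:\ i\ge0,\ j\ge0,\ \frac{i}{a}+\frac{j}{b}\ge1,\ i+j\le a+b-1\Big\}.$$
   Context: Markov polynomials $M_\rho(x,y,z)$, $\rho\in\mathbb{Q}_{\ge0}\cup\{1/0\}$, are defined recursively by $M_{0/1}=x$, $M_{1/0}=y$, $M_{1/1}=(x^2+y^2)/z$, and: whenever $p/q$, $r/s$ are fractions in lowest terms with $p,q,r,s\ge0$, $qr-ps=1$, mediant $\mu=(p+r)/(q+s)$, then $M_{(2p+r)/(2q+s)}=(M_{p/q}^2+M_\mu^2)/M_{r/s}$ and $M_{(p+2r)/(q+2s)}=(M_\mu^2+M_{r/s}^2)/M_{p/q}$. For coprime positive $a,b$ one has $M_{a/b}(x,y,z)=P_{a/b}(x^2,y^2,z^2)/(x^{a-1}y^{b-1}z^{a+b-1})$ with $P_{a/b}(u,v,w)$ a homogeneous polynomial of degree $a+b-1$ (the numerator); $A_{ij}$ denotes the coefficient of $u^iv^jw^{a+b-1-i-j}$ in it.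
   Formalization: The Newton polygon $\Delta_{a/b}$ and the region are compared only at points of ℚ² rather than ℝ², with the convex hull taken using rational weights. -}

module Defs where

open import Data.Nat as ℕ using (ℕ; zero; suc; _∸_)
open import Data.Nat.Properties using (<-cmp)
open import Data.Integer using (+_)
open import Data.Rational as ℚ using (ℚ; 0ℚ; 1ℚ; _+_; _*_; _÷_; _≤_; _<_; ≢-nonZero)
open import Data.Rational.Properties using (_≟_)
open import Data.List using (List; []; _∷_)
open import Data.List.Relation.Unary.All using (All)
open import Data.Product using (_×_; Σ; _,_)
open import Relation.Binary using (tri<; tri≈; tri>)
open import Relation.Binary.PropositionalEquality using (_≡_; _≢_)
open import Relation.Nullary using (yes; no)

ι : ℕ → ℚ
ι n = (+ n) ℚ./ 1

_^_ : ℚ → ℕ → ℚ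
q ^ zero = 1ℚ
q ^ suc n = q * (q ^ n)

-- division in ℚ; the value at denominator 0 is a dummy (0) and is never
-- used below, since all Markov values at positive arguments are positive
_⊘_ : ℚ → ℚ → ℚ
p ⊘ q with q ≟ 0ℚ
... | yes _ = 0ℚ
... | no q≢0 = _÷_ p q {{≢-nonZero q≢0}}

-- Evaluation of the Markov polynomial M_{a/b}(x,y,z), a,b ≥ 1.
-- We walk down the Farey (Stern–Brocot) tree. At a node we have the
-- Farey pair p/q < r/s (qr - ps = 1) with mediant μ = (p+r)/(q+s), and the
-- triple (X , Y , Z) = (M_{p/q} , M_μ , M_{r/s}).
-- Left child pair (p/q, μ): new mediant (2p+r)/(2q+s) with value
--   (M_{p/q}^2 + M_μ^2) / M_{r/s};
-- right child pair (μ, r/s): new mediant (p+2r)/(q+2s) with value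
--   (M_μ^2 + M_{r/s}^2) / M_{p/q}.
-- The first argument is fuel (a + b suffices); exhausting it yields 0,
-- which never happens for positive coprime a, b.
markovWalk : (a b fuel p q r s : ℕ) → (X Y Z : ℚ) → ℚ
markovWalk a b zero p q r s X Y Z = 0ℚ
markovWalk a b (suc f) p q r s X Y Z
  with <-cmp (a ℕ.* (q ℕ.+ s)) (b ℕ.* (p ℕ.+ r))
... | tri< _ _ _ = markovWalk a b f p q (p ℕ.+ r) (q ℕ.+ s)
                     X (((X ^ 2) + (Y ^ 2)) ⊘ Z) Y
... | tri≈ _ _ _ = Y
... | tri> _ _ _ = markovWalk a b f (p ℕ.+ r) (q ℕ.+ s) r s
                     Y (((Y ^ 2) + (Z ^ 2)) ⊘ X) Z

-- M_{a/b}(x,y,z): start at the pair 0/1, 1/0 with mediant 1/1,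
-- M_{0/1} = x, M_{1/1} = (x^2+y^2)/z, M_{1/0} = y.
markov : (a b : ℕ) → ℚ → ℚ → ℚ → ℚ
markov a b x y z =
  markovWalk a b (a ℕ.+ b) 0 1 1 0 x (((x ^ 2) + (y ^ 2)) ⊘ z) y

-- Homogeneous polynomials of degree n in u,v,w given by coefficients
-- A i j of u^i v^j w^(n-i-j)  (only i + j ≤ n is used).

sumTo : ℕ → (ℕ → ℚ) → ℚ
sumTo zero f = f 0
sumTo (suc m) f = sumTo m f + f (suc m)

evalHom : ℕ → (ℕ → ℕ → ℚ) → ℚ → ℚ → ℚ → ℚ
evalHom n A u v w =
  sumTo n (λ i → sumTo (n ∸ i) (λ j →
    A i j * ((u ^ i) * ((v ^ j) * (w ^ ((n ∸ i) ∸ j))))))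

-- A is the coefficient family of the numerator P_{a/b}:
-- M_{a/b}(x,y,z) = P_{a/b}(x²,y²,z²) / (x^(a-1) y^(b-1) z^(a+b-1))
-- as rational functions; we impose it for all positive rationals x,y,z
-- (which determines P uniquely).
IsNumerator : (a b : ℕ) → (ℕ → ℕ → ℚ) → Set
IsNumerator a b A =
  (x y z : ℚ) → 0ℚ < x → 0ℚ < y → 0ℚ < z →
  markov a b x y z * ((x ^ (a ∸ 1)) * ((y ^ (b ∸ 1)) * (z ^ ((a ℕ.+ b) ∸ 1))))
    ≡ evalHom ((a ℕ.+ b) ∸ 1) A (x ^ 2) (y ^ 2) (z ^ 2)

InSupport : ℕ → (ℕ → ℕ → ℚ) → ℕ → ℕ → Set
InSupport n A i j = (i ℕ.+ j ℕ.≤ n) × (A i j ≢ 0ℚ)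

-- Convex hull (over ℚ) of a set S ⊆ ℕ² : finite convex combinations.
-- A weighted point is (i , j , λ).
WPt : Set
WPt = Σ ℕ (λ _ → Σ ℕ (λ _ → ℚ))

wsum : List WPt → ℚ
wsum [] = 0ℚ
wsum ((i , j , l) ∷ ps) = l + wsum ps

wsumI : List WPt → ℚ
wsumI [] = 0ℚ
wsumI ((i , j , l) ∷ ps) = (l * ι i) + wsumI ps

wsumJ : List WPt → ℚ
wsumJ [] = 0ℚ
wsumJ ((i , j , l) ∷ ps) = (l * ι j) + wsumJ ps

GoodPt : (ℕ → ℕ → Set) → WPt → Set
GoodPt S (i , j , l) = S i j × (0ℚ ≤ l)

InConv : (ℕ → ℕ → Set) → ℚ → ℚ → Set
InConv S s t =
  Σ (List WPt) λ ps →
    All (GoodPt S) ps × (wsum ps ≡ 1ℚ) × (wsumI ps ≡ s) × (wsumJ ps ≡ t)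

-- The region {i ≥ 0, j ≥ 0, i/a + j/b ≥ 1, i + j ≤ a + b - 1}
-- (the condition i/a + j/b ≥ 1 is written with denominators cleared,
--  b·i + a·j ≥ a·b, valid as a, b ≥ 1).
InRegion : ℕ → ℕ → ℚ → ℚ → Set
InRegion a b s t =
  (0ℚ ≤ s) × (0ℚ ≤ t) × (ι (a ℕ.* b) ≤ (ι b * s) + (ι a * t))
  × ((s + t) ≤ ι ((a ℕ.+ b) ∸ 1))

InNewton : (a b : ℕ) → (ℕ → ℕ → ℚ) → ℚ → ℚ → Set
InNewton a b A = InConv (InSupport ((a ℕ.+ b) ∸ 1) A)

-- Put x = t ^ α, y = t ^ β, z = t ^ γ and let t → 0.  As Markov values at positive arguments are
-- positive, the order at t = 0 of (X ^ 2 + Y ^ 2) / Z is min (2 ord X) (2 ord Y) - ord Z, so along the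
-- Stern–Brocot path to a/b the orders of the Markov polynomials obey a tropical Markov recursion,
-- solved in closed form by c - |μ p + ν q|.  Multiplying M_{a/b} by the monomial denominator turns
-- it into the sum of A i j t ^ (2 (α i + β j + γ (n - i - j))) with n = a + b - 1, so every
-- coefficient of weight below the order of M_{a/b} vanishes, and a monomial of exactly that weight,
-- when it is the only one, has a nonzero coefficient.  The weights (b N + 1, a N, 0), (b N, a N + 1, 0),
-- (0, 1, 1) and (1, 0, 1), with N > n, show that the support lies on or above the line i/a + j/b = 1
-- and contains (0 , b), (a , 0), (n , 0) and (0 , n).  The region is the convex hull of these four
-- points: cut along the segment from (a , 0) to (0 , n), it is the union of two triangles.

module Submission where

open import Defs

module NewtonPolygon where

  open import Algebra.Bundles using (CommutativeMonoid)
  open import Data.Empty using (⊥; ⊥-elim)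
  open import Data.Integer as ℤ using (ℤ; +_; 0ℤ)
  import Data.Integer.Properties as ℤP
  import Data.Integer.Tactic.RingSolver as ℤ-Solver
  open import Data.List using ([]; _∷_)
  open import Data.List.Relation.Unary.All using (All; []; _∷_)
  open import Data.Nat as ℕ using (ℕ; zero; suc; _∸_; s≤s; z≤n)
  open import Data.Nat.Coprimality using (Coprime; coprime-divisor; 1-coprimeTo)
  import Data.Nat.Coprimality as Coprimality
  open import Data.Nat.Divisibility using (divides; ∣⇒≤)
  open import Data.Nat.DivMod using (_%_; [m+kn]%n≡m%n; m<n⇒m%n≡m)
  import Data.Nat.Properties as ℕP
  import Data.Nat.Tactic.RingSolver as ℕ-Solver
  open import Data.Product using (Σ; _×_; _,_; proj₁; proj₂; uncurry)
  open import Data.Rational as ℚ using (ℚ; mkℚ; 0ℚ; 1ℚ; _+_; _*_; _-_; -_; _≤_; _<_; ∣_∣; positive; nonNegative)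
  import Data.Rational.Properties as ℚP
  open import Data.Rational.Solver using (module +-*-Solver)
  open +-*-Solver using (solve; _:=_; _:+_; _:*_; _:-_; :-_; con)
  open import Data.Sum using (_⊎_; inj₁; inj₂)
  open import Function using (_∘_)
  open import Relation.Binary using (tri<; tri≈; tri>)
  open import Relation.Binary.PropositionalEquality
  open import Relation.Nullary using (yes; no)
  open import Algebra.Properties.CommutativeSemigroup (CommutativeMonoid.commutativeSemigroup ℚP.*-1-commutativeMonoid) using (interchange)

  p≤q⇒0≤q-p : ∀ {p q} → p ≤ q → 0ℚ ≤ q - p
  p≤q⇒0≤q-p {p} {q} p≤q = subst (_≤ q - p) (ℚP.+-inverseʳ p) (ℚP.+-monoˡ-≤ (- p) p≤q)

  +-nonNeg : ∀ {p q} → 0ℚ ≤ p → 0ℚ ≤ q → 0ℚ ≤ p + q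
  +-nonNeg = ℚP.+-mono-≤

  +-pos : ∀ {p q} → 0ℚ < p → 0ℚ ≤ q → 0ℚ < p + q
  +-pos = ℚP.+-mono-<-≤

  *-nonNeg : ∀ {p q} → 0ℚ ≤ p → 0ℚ ≤ q → 0ℚ ≤ p * q
  *-nonNeg {p} {q} 0≤p 0≤q =
    ℚP.nonNegative⁻¹ _ {{ℚP.nonNeg*nonNeg⇒nonNeg p {{nonNegative 0≤p}} q {{nonNegative 0≤q}}}}

  *-pos : ∀ {p q} → 0ℚ < p → 0ℚ < q → 0ℚ < p * q
  *-pos {p} {q} 0<p 0<q = ℚP.positive⁻¹ _ {{ℚP.pos*pos⇒pos p {{positive 0<p}} q {{positive 0<q}}}}

  pos-factor : ∀ {p q} → 0ℚ < q → 0ℚ < p * q → 0ℚ < p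
  pos-factor {p} {q} 0<q 0<pq =
    ℚP.*-cancelʳ-<-nonNeg q {{nonNegative (ℚP.<⇒≤ 0<q)}} (subst (_< p * q) (sym (ℚP.*-zeroˡ q)) 0<pq)

  *-monoˡ-≤ : ∀ {r p q} → 0ℚ ≤ r → p ≤ q → r * p ≤ r * q
  *-monoˡ-≤ {r} 0≤r = ℚP.*-monoˡ-≤-nonNeg r {{nonNegative 0≤r}}

  *-monoʳ-≤ : ∀ {r p q} → 0ℚ ≤ r → p ≤ q → p * r ≤ q * r
  *-monoʳ-≤ {r} 0≤r = ℚP.*-monoʳ-≤-nonNeg r {{nonNegative 0≤r}}

  *-mono-≤ : ∀ {p q r s} → 0ℚ ≤ p → 0ℚ ≤ r → p ≤ q → r ≤ s → p * r ≤ q * s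
  *-mono-≤ 0≤p 0≤r p≤q r≤s =
    ℚP.≤-trans (*-monoʳ-≤ 0≤r p≤q) (*-monoˡ-≤ (ℚP.≤-trans 0≤p p≤q) r≤s)

  *-cancelʳ-≤ : ∀ {r p q} → 0ℚ < r → p * r ≤ q * r → p ≤ q
  *-cancelʳ-≤ {r} 0<r = ℚP.*-cancelʳ-≤-pos r {{positive 0<r}}

  0<1 : 0ℚ < 1ℚ
  0<1 = ℚP.positive⁻¹ 1ℚ

  ⊘-cancelʳ : ∀ p {q} → 0ℚ < q → (p ⊘ q) * q ≡ p
  ⊘-cancelʳ p {q} 0<q with q ℚP.≟ 0ℚ
  ... | yes q≡0 = ⊥-elim (ℚP.<-irrefl (sym q≡0) 0<q)
  ... | no q≢0 = begin
    p * ℚ.1/_ q {{≢0}} * q   ≡⟨ ℚP.*-assoc p _ q ⟩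
    p * (ℚ.1/_ q {{≢0}} * q) ≡⟨ cong (p *_) (ℚP.*-inverseˡ q {{≢0}}) ⟩
    p * 1ℚ                   ≡⟨ ℚP.*-identityʳ p ⟩
    p                        ∎
    where open ≡-Reasoning
          ≢0 = ℚ.≢-nonZero q≢0

  ⊘-pos : ∀ {p q} → 0ℚ < p → 0ℚ < q → 0ℚ < p ⊘ q
  ⊘-pos {p} 0<p 0<q = pos-factor 0<q (subst (0ℚ <_) (sym (⊘-cancelʳ p 0<q)) 0<p)

  ∃-small : ∀ {a K} → 0ℚ < a → 0ℚ ≤ K → Σ ℚ λ t → 0ℚ < t × t ≤ 1ℚ × K * t < a
  ∃-small {a} {K} 0<a 0≤K = t , 0<t , t≤1 , Kt<a
    where
    d = K + a + 1ℚ
    a≤d : a ≤ d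
    a≤d = subst (_≤ d) (trans (ℚP.+-identityʳ _) (ℚP.+-identityˡ a))
            (ℚP.+-mono-≤ (ℚP.+-monoˡ-≤ a 0≤K) (ℚP.<⇒≤ 0<1))
    K<d : K < d
    K<d = subst (_< d) (trans (ℚP.+-identityʳ _) (ℚP.+-identityʳ K))
            (ℚP.+-mono-≤-< (ℚP.+-monoʳ-≤ K (ℚP.<⇒≤ 0<a)) 0<1)
    0<d : 0ℚ < d
    0<d = ℚP.<-≤-trans 0<a a≤d
    t = a ⊘ d
    0<t : 0ℚ < t
    0<t = ⊘-pos 0<a 0<d
    t≤1 : t ≤ 1ℚ
    t≤1 = *-cancelʳ-≤ 0<d (subst₂ _≤_ (sym (⊘-cancelʳ a 0<d)) (sym (ℚP.*-identityˡ d)) a≤d)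
    Kt<a : K * t < a
    Kt<a = subst₂ _<_ (ℚP.*-comm t K) (⊘-cancelʳ a 0<d)
             (ℚP.*-monoʳ-<-pos t {{positive 0<t}} K<d)

  ^-distribˡ-+-* : ∀ t m n → t ^ (m ℕ.+ n) ≡ t ^ m * t ^ n
  ^-distribˡ-+-* t zero n = sym (ℚP.*-identityˡ _)
  ^-distribˡ-+-* t (suc m) n = trans (cong (t *_) (^-distribˡ-+-* t m n)) (sym (ℚP.*-assoc t _ _))

  ^-*-assoc : ∀ t m n → (t ^ m) ^ n ≡ t ^ (m ℕ.* n)
  ^-*-assoc t m zero = cong (t ^_) (sym (ℕP.*-zeroʳ m))
  ^-*-assoc t m (suc n) = begin
    t ^ m * (t ^ m) ^ n        ≡⟨ cong (t ^ m *_) (^-*-assoc t m n) ⟩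
    t ^ m * t ^ (m ℕ.* n)      ≡⟨ sym (^-distribˡ-+-* t m (m ℕ.* n)) ⟩
    t ^ (m ℕ.+ m ℕ.* n)        ≡⟨ cong (t ^_) (sym (ℕP.*-suc m n)) ⟩
    t ^ (m ℕ.* suc n)          ∎
    where open ≡-Reasoning

  ^-pos : ∀ {t} n → 0ℚ < t → 0ℚ < t ^ n
  ^-pos zero 0<t = 0<1
  ^-pos (suc n) 0<t = *-pos 0<t (^-pos n 0<t)

  ^-nonNeg : ∀ {t} n → 0ℚ ≤ t → 0ℚ ≤ t ^ n
  ^-nonNeg zero 0≤t = ℚP.<⇒≤ 0<1
  ^-nonNeg (suc n) 0≤t = *-nonNeg 0≤t (^-nonNeg n 0≤t)

  ^-≤1 : ∀ {t} n → 0ℚ ≤ t → t ≤ 1ℚ → t ^ n ≤ 1ℚ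
  ^-≤1 zero 0≤t t≤1 = ℚP.≤-refl
  ^-≤1 {t} (suc n) 0≤t t≤1 =
    subst (t * t ^ n ≤_) (ℚP.*-identityˡ 1ℚ) (*-mono-≤ 0≤t (^-nonNeg n 0≤t) t≤1 (^-≤1 n 0≤t t≤1))

  ^-antimono : ∀ {t m n} → 0ℚ ≤ t → t ≤ 1ℚ → m ℕ.≤ n → t ^ n ≤ t ^ m
  ^-antimono {t} {m} 0≤t t≤1 m≤n with ℕP.m≤n⇒∃[o]m+o≡n m≤n
  ... | o , refl = subst₂ _≤_ (sym (^-distribˡ-+-* t m o)) (ℚP.*-identityʳ _)
                     (*-monoˡ-≤ (^-nonNeg m 0≤t) (^-≤1 o 0≤t t≤1))

  ⊘≡*1⊘ : ∀ p q → p ⊘ q ≡ p * (1ℚ ⊘ q)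
  ⊘≡*1⊘ p q with q ℚP.≟ 0ℚ
  ... | yes _ = sym (ℚP.*-zeroʳ p)
  ... | no q≢0 = cong (p *_) (sym (ℚP.*-identityˡ _))

  1⊘-reverses-≤ : ∀ {x y P Q} → 0ℚ < x → 0ℚ < y → x * P ≤ y * Q → (1ℚ ⊘ y) * P ≤ (1ℚ ⊘ x) * Q
  1⊘-reverses-≤ {x} {y} {P} {Q} 0<x 0<y xP≤yQ = begin
    (1ℚ ⊘ y) * P                          ≡⟨ cancel x (1ℚ ⊘ y) P (1ℚ ⊘ x) (⊘-cancelʳ 1ℚ 0<x) ⟨
    ((1ℚ ⊘ x) * (1ℚ ⊘ y)) * (x * P)     ≤⟨ *-monoˡ-≤ 0≤x⁻¹y⁻¹ xP≤yQ ⟩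
    ((1ℚ ⊘ x) * (1ℚ ⊘ y)) * (y * Q)     ≡⟨ cong (_* (y * Q)) (ℚP.*-comm (1ℚ ⊘ x) (1ℚ ⊘ y)) ⟩
    ((1ℚ ⊘ y) * (1ℚ ⊘ x)) * (y * Q)     ≡⟨ cancel y (1ℚ ⊘ x) Q (1ℚ ⊘ y) (⊘-cancelʳ 1ℚ 0<y) ⟩
    (1ℚ ⊘ x) * Q                          ∎
    where
    open ℚP.≤-Reasoning
    0≤x⁻¹y⁻¹ = *-nonNeg (ℚP.<⇒≤ (⊘-pos 0<1 0<x)) (ℚP.<⇒≤ (⊘-pos 0<1 0<y))
    cancel : ∀ x u P x⁻¹ → x⁻¹ * x ≡ 1ℚ → (x⁻¹ * u) * (x * P) ≡ u * P
    cancel x u P x⁻¹ inv = begin-equality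
      (x⁻¹ * u) * (x * P) ≡⟨ interchange x⁻¹ u x P ⟩
      (x⁻¹ * x) * (u * P) ≡⟨ cong (_* (u * P)) inv ⟩
      1ℚ * (u * P)        ≡⟨ ℚP.*-identityˡ _ ⟩
      u * P               ∎

  -- Orders of magnitude at t = 0

  -- g t ≍ t ^ m / t ^ k for t ∈ (0,1]; m - k is the order of g at t = 0.
  record IsΘ (g : ℚ → ℚ) (m k : ℕ) : Set where
    field
      lo hi : ℚ
      lo-pos : 0ℚ < lo
      lower : ∀ {t} → 0ℚ < t → t ≤ 1ℚ → lo * t ^ m ≤ g t * t ^ k
      upper : ∀ {t} → 0ℚ < t → t ≤ 1ℚ → g t * t ^ k ≤ hi * t ^ m

    pos : ∀ {t} → 0ℚ < t → t ≤ 1ℚ → 0ℚ < g t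
    pos {t} 0<t t≤1 = pos-factor (^-pos k 0<t)
      (ℚP.<-≤-trans (*-pos lo-pos (^-pos m 0<t)) (lower 0<t t≤1))

    hi-pos : 0ℚ < hi
    hi-pos = pos-factor (^-pos m 0<1)
      (ℚP.<-≤-trans (*-pos lo-pos (^-pos m 0<1)) (ℚP.≤-trans (lower 0<1 ℚP.≤-refl) (upper 0<1 ℚP.≤-refl)))

  open IsΘ

  IsΘ-cong : ∀ {g h m k} → (∀ {t} → 0ℚ < t → g t ≡ h t) → IsΘ g m k → IsΘ h m k
  IsΘ-cong {m = m} {k} g≗h Θg = record
    { lo = lo Θg ; hi = hi Θg ; lo-pos = lo-pos Θg
    ; lower = λ {t} 0<t t≤1 → subst (λ v → lo Θg * t ^ m ≤ v * t ^ k) (g≗h 0<t) (lower Θg 0<t t≤1)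
    ; upper = λ {t} 0<t t≤1 → subst (λ v → v * t ^ k ≤ hi Θg * t ^ m) (g≗h 0<t) (upper Θg 0<t t≤1)
    }

  IsΘ-pow : ∀ α → IsΘ (λ t → t ^ α) α 0
  IsΘ-pow α = record
    { lo = 1ℚ ; hi = 1ℚ ; lo-pos = 0<1
    ; lower = λ {t} _ _ → ℚP.≤-reflexive (trans (ℚP.*-identityˡ (t ^ α)) (sym (ℚP.*-identityʳ (t ^ α))))
    ; upper = λ {t} _ _ → ℚP.≤-reflexive (trans (ℚP.*-identityʳ (t ^ α)) (sym (ℚP.*-identityˡ (t ^ α))))
    }

  IsΘ-one : ∀ d → IsΘ (λ _ → 1ℚ) d d
  IsΘ-one d = record
    { lo = 1ℚ ; hi = 1ℚ ; lo-pos = 0<1 ; lower = λ _ _ → ℚP.≤-refl ; upper = λ _ _ → ℚP.≤-refl }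

  IsΘ-* : ∀ {g h m m′ k k′} → IsΘ g m k → IsΘ h m′ k′ → IsΘ (λ t → g t * h t) (m ℕ.+ m′) (k ℕ.+ k′)
  IsΘ-* {g} {h} {m} {m′} {k} {k′} Θg Θh = record
    { lo = lo Θg * lo Θh ; hi = hi Θg * hi Θh ; lo-pos = *-pos (lo-pos Θg) (lo-pos Θh)
    ; lower = λ {t} 0<t t≤1 → subst₂ _≤_ (split (lo Θg) (lo Θh) m m′) (split (g t) (h t) k k′)
        (*-mono-≤ (lo-t^m Θg 0<t) (lo-t^m Θh 0<t) (lower Θg 0<t t≤1) (lower Θh 0<t t≤1))
    ; upper = λ {t} 0<t t≤1 → subst₂ _≤_ (split (g t) (h t) k k′) (split (hi Θg) (hi Θh) m m′)
        (*-mono-≤ (g-t^k Θg 0<t t≤1) (g-t^k Θh 0<t t≤1) (upper Θg 0<t t≤1) (upper Θh 0<t t≤1))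
    }
    where
    split : ∀ {t} x y i j → (x * t ^ i) * (y * t ^ j) ≡ (x * y) * t ^ (i ℕ.+ j)
    split {t} x y i j = trans (interchange x (t ^ i) y (t ^ j)) (cong ((x * y) *_) (sym (^-distribˡ-+-* t i j)))
    lo-t^m : ∀ {f i j t} (Θf : IsΘ f i j) → 0ℚ < t → 0ℚ ≤ lo Θf * t ^ i
    lo-t^m {i = i} Θf 0<t = ℚP.<⇒≤ (*-pos (lo-pos Θf) (^-pos i 0<t))
    g-t^k : ∀ {f i j t} (Θf : IsΘ f i j) → 0ℚ < t → t ≤ 1ℚ → 0ℚ ≤ f t * t ^ j
    g-t^k Θf 0<t t≤1 = ℚP.≤-trans (lo-t^m Θf 0<t) (lower Θf 0<t t≤1)

  IsΘ-≡ : ∀ {g m m′ k k′} → m ≡ m′ → k ≡ k′ → IsΘ g m k → IsΘ g m′ k′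
  IsΘ-≡ refl refl Θg = Θg

  IsΘ-shift : ∀ {g m k} d → IsΘ g m k → IsΘ g (m ℕ.+ d) (k ℕ.+ d)
  IsΘ-shift d Θg = IsΘ-cong (λ _ → ℚP.*-identityʳ _) (IsΘ-* Θg (IsΘ-one d))

  IsΘ-square : ∀ {g m k} → IsΘ g m k → IsΘ (λ t → g t ^ 2) (m ℕ.+ m) (k ℕ.+ k)
  IsΘ-square {m = m} {k} Θg =
    IsΘ-≡ (cong (m ℕ.+_) (ℕP.+-identityʳ m)) (cong (k ℕ.+_) (ℕP.+-identityʳ k))
          (IsΘ-* Θg (IsΘ-* Θg (IsΘ-one 0)))

  IsΘ-inv : ∀ {h m k} → IsΘ h m k → IsΘ (λ t → 1ℚ ⊘ h t) k m
  IsΘ-inv Θh = record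
    { lo = 1ℚ ⊘ hi Θh ; hi = 1ℚ ⊘ lo Θh ; lo-pos = ⊘-pos 0<1 (hi-pos Θh)
    ; lower = λ 0<t t≤1 → 1⊘-reverses-≤ (pos Θh 0<t t≤1) (hi-pos Θh) (upper Θh 0<t t≤1)
    ; upper = λ 0<t t≤1 → 1⊘-reverses-≤ (lo-pos Θh) (pos Θh 0<t t≤1) (lower Θh 0<t t≤1)
    }

  IsΘ-+-≤ : ∀ {g h m m′ k} → m ℕ.≤ m′ → IsΘ g m k → IsΘ h m′ k → IsΘ (λ t → g t + h t) m k
  IsΘ-+-≤ {g} {h} {m} {m′} {k} m≤m′ Θg Θh = record
    { lo = lo Θg ; hi = hi Θg + hi Θh ; lo-pos = lo-pos Θg
    ; lower = λ {t} 0<t t≤1 → begin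
        lo Θg * t ^ m          ≤⟨ lower Θg 0<t t≤1 ⟩
        g t * t ^ k            ≡⟨ ℚP.+-identityʳ _ ⟨
        g t * t ^ k + 0ℚ       ≤⟨ ℚP.+-monoʳ-≤ (g t * t ^ k) (h-t^k-nonNeg 0<t t≤1) ⟩
        g t * t ^ k + h t * t ^ k ≡⟨ ℚP.*-distribʳ-+ (t ^ k) (g t) (h t) ⟨
        (g t + h t) * t ^ k    ∎
    ; upper = λ {t} 0<t t≤1 → begin
        (g t + h t) * t ^ k            ≡⟨ ℚP.*-distribʳ-+ (t ^ k) (g t) (h t) ⟩
        g t * t ^ k + h t * t ^ k      ≤⟨ ℚP.+-mono-≤ (upper Θg 0<t t≤1) (upper Θh 0<t t≤1) ⟩
        hi Θg * t ^ m + hi Θh * t ^ m′ ≤⟨ ℚP.+-monoʳ-≤ (hi Θg * t ^ m)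
                                            (*-monoˡ-≤ (ℚP.<⇒≤ (hi-pos Θh)) (^-antimono (ℚP.<⇒≤ 0<t) t≤1 m≤m′)) ⟩
        hi Θg * t ^ m + hi Θh * t ^ m  ≡⟨ ℚP.*-distribʳ-+ (t ^ m) (hi Θg) (hi Θh) ⟨
        (hi Θg + hi Θh) * t ^ m        ∎
    }
    where
    open ℚP.≤-Reasoning
    h-t^k-nonNeg : ∀ {t} → 0ℚ < t → t ≤ 1ℚ → 0ℚ ≤ h t * t ^ k
    h-t^k-nonNeg 0<t t≤1 = *-nonNeg (ℚP.<⇒≤ (pos Θh 0<t t≤1)) (^-nonNeg k (ℚP.<⇒≤ 0<t))

  IsΘ-+ : ∀ {g h m m′ k} → IsΘ g m k → IsΘ h m′ k → IsΘ (λ t → g t + h t) (m ℕ.⊓ m′) k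
  IsΘ-+ {g} {h} {m} {m′} Θg Θh with ℕP.≤-total m m′
  ... | inj₁ m≤m′ = IsΘ-≡ (sym (ℕP.m≤n⇒m⊓n≡m m≤m′)) refl (IsΘ-+-≤ m≤m′ Θg Θh)
  ... | inj₂ m′≤m = IsΘ-≡ (sym (ℕP.m≥n⇒m⊓n≡n m′≤m)) refl
                      (IsΘ-cong (λ {t} _ → ℚP.+-comm (h t) (g t)) (IsΘ-+-≤ m′≤m Θh Θg))

  IsΘ-unshift : ∀ {g m k} d → IsΘ g (m ℕ.+ d) (k ℕ.+ d) → IsΘ g m k
  IsΘ-unshift {g} {m} {k} d Θg = record
    { lo = lo Θg ; hi = hi Θg ; lo-pos = lo-pos Θg
    ; lower = λ {t} 0<t t≤1 → *-cancelʳ-≤ (^-pos d 0<t)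
        (subst₂ _≤_ (split (lo Θg) m) (split (g t) k) (lower Θg 0<t t≤1))
    ; upper = λ {t} 0<t t≤1 → *-cancelʳ-≤ (^-pos d 0<t)
        (subst₂ _≤_ (split (g t) k) (split (hi Θg) m) (upper Θg 0<t t≤1))
    }
    where
    split : ∀ {t} x i → x * t ^ (i ℕ.+ d) ≡ (x * t ^ i) * t ^ d
    split {t} x i = trans (cong (x *_) (^-distribˡ-+-* t i d)) (sym (ℚP.*-assoc x _ _))

  IsΘ₀-lower : ∀ {g m} (Θg : IsΘ g m 0) {t} → 0ℚ < t → t ≤ 1ℚ → lo Θg * t ^ m ≤ g t
  IsΘ₀-lower {g} Θg {t} 0<t t≤1 = subst (_ ≤_) (ℚP.*-identityʳ (g t)) (lower Θg 0<t t≤1)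

  IsΘ₀-upper : ∀ {g m} (Θg : IsΘ g m 0) {t} → 0ℚ < t → t ≤ 1ℚ → ∣ g t ∣ ≤ hi Θg * t ^ m
  IsΘ₀-upper {g} Θg {t} 0<t t≤1 =
    subst (_≤ _) (trans (ℚP.*-identityʳ (g t)) (sym (ℚP.0≤p⇒∣p∣≡p (ℚP.<⇒≤ (pos Θg 0<t t≤1))))) (upper Θg 0<t t≤1)

  diff-≡ : ∀ {x y z w} → x ℤ.+ w ≡ z ℤ.+ y → x ℤ.- y ≡ z ℤ.- w
  diff-≡ {x} {y} {z} {w} x+w≡z+y = begin
    x ℤ.- y                   ≡⟨ shift x y w ⟩
    (x ℤ.+ w) ℤ.- (y ℤ.+ w)   ≡⟨ cong (ℤ._- (y ℤ.+ w)) x+w≡z+y ⟩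
    (z ℤ.+ y) ℤ.- (y ℤ.+ w)   ≡⟨ cancel z y w ⟩
    z ℤ.- w                   ∎
    where
    open ≡-Reasoning
    shift : ∀ x y w → x ℤ.- y ≡ (x ℤ.+ w) ℤ.- (y ℤ.+ w)
    shift = ℤ-Solver.solve-∀
    cancel : ∀ z y w → (z ℤ.+ y) ℤ.- (y ℤ.+ w) ≡ z ℤ.- w
    cancel = ℤ-Solver.solve-∀

  diff-injective : ∀ {x y z w} → x ℤ.- y ≡ z ℤ.- w → x ℤ.+ w ≡ z ℤ.+ y
  diff-injective {x} {y} {z} {w} x-y≡z-w = begin
    x ℤ.+ w                     ≡⟨ split x y w ⟩
    (x ℤ.- y) ℤ.+ (y ℤ.+ w)     ≡⟨ cong (ℤ._+ (y ℤ.+ w)) x-y≡z-w ⟩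
    (z ℤ.- w) ℤ.+ (y ℤ.+ w)     ≡⟨ merge z y w ⟩
    z ℤ.+ y                     ∎
    where
    open ≡-Reasoning
    split : ∀ x y w → x ℤ.+ w ≡ (x ℤ.- y) ℤ.+ (y ℤ.+ w)
    split = ℤ-Solver.solve-∀
    merge : ∀ z y w → (z ℤ.- w) ℤ.+ (y ℤ.+ w) ≡ z ℤ.+ y
    merge = ℤ-Solver.solve-∀

  pos-diff-injective : ∀ {a b c d} → + a ℤ.- + b ≡ + c ℤ.- + d → a ℕ.+ d ≡ c ℕ.+ b
  pos-diff-injective {a} {b} {c} {d} eq =
    ℤP.+-injective (trans (ℤP.pos-+ a d) (trans (diff-injective {+ a} {+ b} {+ c} {+ d} eq) (sym (ℤP.pos-+ c b))))

  pos-diff-+ : ∀ a b c d → + (a ℕ.+ c) ℤ.- + (b ℕ.+ d) ≡ (+ a ℤ.- + b) ℤ.+ (+ c ℤ.- + d)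
  pos-diff-+ a b c d = begin
    + (a ℕ.+ c) ℤ.- + (b ℕ.+ d)       ≡⟨ cong₂ ℤ._-_ (ℤP.pos-+ a c) (ℤP.pos-+ b d) ⟩
    (+ a ℤ.+ + c) ℤ.- (+ b ℤ.+ + d)   ≡⟨ regroup (+ a) (+ b) (+ c) (+ d) ⟩
    (+ a ℤ.- + b) ℤ.+ (+ c ℤ.- + d)   ∎
    where
    open ≡-Reasoning
    regroup : ∀ a b c d → (a ℤ.+ c) ℤ.- (b ℤ.+ d) ≡ (a ℤ.- b) ℤ.+ (c ℤ.- d)
    regroup = ℤ-Solver.solve-∀

  HasOrder : (ℚ → ℚ) → ℤ → Set
  HasOrder g e = Σ ℕ λ m → Σ ℕ λ k → (+ m ℤ.- + k ≡ e) × IsΘ g m k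

  HasOrder-pow : ∀ α → HasOrder (λ t → t ^ α) (+ α)
  HasOrder-pow α = α , 0 , ℤP.+-identityʳ (+ α) , IsΘ-pow α

  -- the tropicalisation of (X, Y, Z) ↦ (X ^ 2 + Y ^ 2) / Z
  tropicalStep : ℤ → ℤ → ℤ → ℤ
  tropicalStep e₁ e₂ e₃ = ((e₁ ℤ.+ e₁) ℤ.⊓ (e₂ ℤ.+ e₂)) ℤ.- e₃

  tropicalStep-comm : ∀ e₁ e₂ e₃ → tropicalStep e₁ e₂ e₃ ≡ tropicalStep e₂ e₁ e₃
  tropicalStep-comm e₁ e₂ e₃ = cong (ℤ._- e₃) (ℤP.⊓-comm (e₁ ℤ.+ e₁) (e₂ ℤ.+ e₂))

  HasOrder-step : ∀ {X Y Z e₁ e₂ e₃} → HasOrder X e₁ → HasOrder Y e₂ → HasOrder Z e₃ →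
    HasOrder (λ t → (X t ^ 2 + Y t ^ 2) ⊘ Z t) (tropicalStep e₁ e₂ e₃)
  HasOrder-step {X} {Y} {Z} (m₁ , k₁ , refl , Θ₁) (m₂ , k₂ , refl , Θ₂) (m₃ , k₃ , refl , Θ₃) =
    x ℕ.⊓ y ℕ.+ k₃ , K ℕ.+ m₃ , order ,
    IsΘ-cong (λ {t} _ → sym (⊘≡*1⊘ (X t ^ 2 + Y t ^ 2) (Z t)))
      (IsΘ-* (IsΘ-+ (IsΘ-shift (k₂ ℕ.+ k₂) (IsΘ-square Θ₁))
                    (IsΘ-≡ refl (ℕP.+-comm (k₂ ℕ.+ k₂) (k₁ ℕ.+ k₁)) (IsΘ-shift (k₁ ℕ.+ k₁) (IsΘ-square Θ₂))))
             (IsΘ-inv Θ₃))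
    where
    x = (m₁ ℕ.+ m₁) ℕ.+ (k₂ ℕ.+ k₂)
    y = (m₂ ℕ.+ m₂) ℕ.+ (k₁ ℕ.+ k₁)
    K = (k₁ ℕ.+ k₁) ℕ.+ (k₂ ℕ.+ k₂)
    e₁ = + m₁ ℤ.- + k₁
    e₂ = + m₂ ℤ.- + k₂
    e₃ = + m₃ ℤ.- + k₃
    shifted : ∀ m k d → + ((m ℕ.+ m) ℕ.+ d) ℤ.- + ((k ℕ.+ k) ℕ.+ d) ≡ (+ m ℤ.- + k) ℤ.+ (+ m ℤ.- + k)
    shifted m k d = begin
      + ((m ℕ.+ m) ℕ.+ d) ℤ.- + ((k ℕ.+ k) ℕ.+ d)          ≡⟨ pos-diff-+ (m ℕ.+ m) (k ℕ.+ k) d d ⟩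
      (+ (m ℕ.+ m) ℤ.- + (k ℕ.+ k)) ℤ.+ (+ d ℤ.- + d)        ≡⟨ cong (λ v → + (m ℕ.+ m) ℤ.- + (k ℕ.+ k) ℤ.+ v) (ℤP.+-inverseʳ (+ d)) ⟩
      (+ (m ℕ.+ m) ℤ.- + (k ℕ.+ k)) ℤ.+ 0ℤ                   ≡⟨ ℤP.+-identityʳ _ ⟩
      + (m ℕ.+ m) ℤ.- + (k ℕ.+ k)                             ≡⟨ pos-diff-+ m k m k ⟩
      (+ m ℤ.- + k) ℤ.+ (+ m ℤ.- + k)                         ∎
      where open ≡-Reasoning
    open ≡-Reasoning
    order : + (x ℕ.⊓ y ℕ.+ k₃) ℤ.- + (K ℕ.+ m₃) ≡ tropicalStep e₁ e₂ e₃
    order = begin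
      + (x ℕ.⊓ y ℕ.+ k₃) ℤ.- + (K ℕ.+ m₃)             ≡⟨ pos-diff-+ (x ℕ.⊓ y) K k₃ m₃ ⟩
      (+ (x ℕ.⊓ y) ℤ.- + K) ℤ.+ (+ k₃ ℤ.- + m₃)       ≡⟨ flip (+ (x ℕ.⊓ y) ℤ.- + K) (+ k₃) (+ m₃) ⟩
      (+ (x ℕ.⊓ y) ℤ.- + K) ℤ.- e₃                    ≡⟨ cong (ℤ._- e₃) (ℤP.mono-≤-distrib-⊓ (ℤP.+-monoˡ-≤ (ℤ.- + K)) (+ x) (+ y)) ⟩
      ((+ x ℤ.- + K) ℤ.⊓ (+ y ℤ.- + K)) ℤ.- e₃        ≡⟨ cong (ℤ._- e₃) (cong₂ ℤ._⊓_ (shifted m₁ k₁ (k₂ ℕ.+ k₂))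
                                                            (trans (cong (λ v → + y ℤ.- + v) (ℕP.+-comm (k₁ ℕ.+ k₁) (k₂ ℕ.+ k₂)))
                                                                   (shifted m₂ k₂ (k₁ ℕ.+ k₁)))) ⟩
      tropicalStep e₁ e₂ e₃                           ∎
      where
      flip : ∀ u k m → u ℤ.+ (k ℤ.- m) ≡ u ℤ.- (m ℤ.- k)
      flip = ℤ-Solver.solve-∀

  HasOrder-* : ∀ {g h e e′} → HasOrder g e → HasOrder h e′ → HasOrder (λ t → g t * h t) (e ℤ.+ e′)
  HasOrder-* (m , k , refl , Θg) (m′ , k′ , refl , Θh) = m ℕ.+ m′ , k ℕ.+ k′ , pos-diff-+ m k m′ k′ , IsΘ-* Θg Θh

  HasOrder-exact : ∀ {g E} → HasOrder g (+ E) → IsΘ g E 0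
  HasOrder-exact {E = E} (m , k , m-k≡E , Θg) =
    IsΘ-unshift k (IsΘ-≡ m≡E+k refl Θg)
    where
    m≡E+k : m ≡ E ℕ.+ k
    m≡E+k = trans (sym (ℕP.+-identityʳ m))
                  (pos-diff-injective {m} {k} {E} {0} (trans m-k≡E (sym (ℤP.+-identityʳ (+ E)))))

  pos-diff-+-pos : ∀ {X Y Z W} → X ℕ.+ Z ≡ W ℕ.+ Y → (+ X ℤ.- + Y) ℤ.+ + Z ≡ + W
  pos-diff-+-pos {X} {Y} {Z} {W} X+Z≡W+Y = begin
    (+ X ℤ.- + Y) ℤ.+ + Z      ≡⟨ swap (+ X) (+ Y) (+ Z) ⟩
    (+ X ℤ.+ + Z) ℤ.- + Y      ≡⟨ cong (ℤ._- + Y) (trans (sym (ℤP.pos-+ X Z)) (trans (cong +_ X+Z≡W+Y) (ℤP.pos-+ W Y))) ⟩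
    (+ W ℤ.+ + Y) ℤ.- + Y      ≡⟨ cancel (+ W) (+ Y) ⟩
    + W                        ∎
    where
    open ≡-Reasoning
    swap : ∀ x y z → (x ℤ.- y) ℤ.+ z ≡ (x ℤ.+ z) ℤ.- y
    swap = ℤ-Solver.solve-∀
    cancel : ∀ w y → (w ℤ.+ y) ℤ.- y ≡ w
    cancel = ℤ-Solver.solve-∀

  -- The Stern–Brocot walk

  record FareyBracket (a b p q r s : ℕ) : Set where
    field
      neighbours : q ℕ.* r ≡ p ℕ.* s ℕ.+ 1
      left<      : b ℕ.* p ℕ.< a ℕ.* q
      <right     : a ℕ.* s ℕ.< b ℕ.* r

  open FareyBracket

  FareyBracket-mirror : ∀ {a b p q r s} → FareyBracket a b p q r s → FareyBracket b a s r q p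
  FareyBracket-mirror {p = p} {q} {r} {s} br = record
    { neighbours = trans (ℕP.*-comm r q) (trans (neighbours br) (cong (ℕ._+ 1) (ℕP.*-comm p s)))
    ; left< = <right br
    ; <right = left< br
    }

  -- r (b p + 1) + p (a s + 1) ≤ r (a q) + p (b r), and a (q r) = a (p s + 1)
  FareyBracket-numerators : ∀ {a b p q r s} → FareyBracket a b p q r s → p ℕ.+ r ℕ.≤ a
  FareyBracket-numerators {a} {b} {p} {q} {r} {s} br =
    ℕP.+-cancelˡ-≤ (r ℕ.* b ℕ.* p ℕ.+ p ℕ.* a ℕ.* s) (p ℕ.+ r) a
      (subst₂ ℕ._≤_ (lhs a b p r s) rhs (ℕP.+-mono-≤ (ℕP.*-monoʳ-≤ r (left< br)) (ℕP.*-monoʳ-≤ p (<right br))))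
    where
    lhs : ∀ a b p r s → r ℕ.* suc (b ℕ.* p) ℕ.+ p ℕ.* suc (a ℕ.* s) ≡ (r ℕ.* b ℕ.* p ℕ.+ p ℕ.* a ℕ.* s) ℕ.+ (p ℕ.+ r)
    lhs = ℕ-Solver.solve-∀
    rhs : r ℕ.* (a ℕ.* q) ℕ.+ p ℕ.* (b ℕ.* r) ≡ (r ℕ.* b ℕ.* p ℕ.+ p ℕ.* a ℕ.* s) ℕ.+ a
    rhs = begin
      r ℕ.* (a ℕ.* q) ℕ.+ p ℕ.* (b ℕ.* r)   ≡⟨ e₁ a b p q r ⟩
      a ℕ.* (q ℕ.* r) ℕ.+ r ℕ.* b ℕ.* p     ≡⟨ cong (λ v → a ℕ.* v ℕ.+ r ℕ.* b ℕ.* p) (neighbours br) ⟩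
      a ℕ.* (p ℕ.* s ℕ.+ 1) ℕ.+ r ℕ.* b ℕ.* p ≡⟨ e₂ a b p r s ⟩
      (r ℕ.* b ℕ.* p ℕ.+ p ℕ.* a ℕ.* s) ℕ.+ a ∎
      where
      open ≡-Reasoning
      e₁ : ∀ a b p q r → r ℕ.* (a ℕ.* q) ℕ.+ p ℕ.* (b ℕ.* r) ≡ a ℕ.* (q ℕ.* r) ℕ.+ r ℕ.* b ℕ.* p
      e₁ = ℕ-Solver.solve-∀
      e₂ : ∀ a b p r s → a ℕ.* (p ℕ.* s ℕ.+ 1) ℕ.+ r ℕ.* b ℕ.* p ≡ (r ℕ.* b ℕ.* p ℕ.+ p ℕ.* a ℕ.* s) ℕ.+ a
      e₂ = ℕ-Solver.solve-∀

  FareyBracket-denominators : ∀ {a b p q r s} → FareyBracket a b p q r s → q ℕ.+ s ℕ.≤ b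
  FareyBracket-denominators {b = b} {q = q} {s = s} br =
    subst (ℕ._≤ b) (ℕP.+-comm s q) (FareyBracket-numerators (FareyBracket-mirror br))

  FareyBracket-den>0 : ∀ {a b p q r s} → FareyBracket a b p q r s → 0 ℕ.< q
  FareyBracket-den>0 {a} {b} {p} br = ℕP.n≢0⇒n>0 λ q≡0 →
    ℕP.n≮0 (subst (b ℕ.* p ℕ.<_) (trans (cong (a ℕ.*_) q≡0) (ℕP.*-zeroʳ a)) (left< br))

  FareyBracket-left : ∀ {a b p q r s} → FareyBracket a b p q r s → a ℕ.* (q ℕ.+ s) ℕ.< b ℕ.* (p ℕ.+ r) →
    FareyBracket a b p q (p ℕ.+ r) (q ℕ.+ s)
  FareyBracket-left {p = p} {q} {r} {s} br lt = record
    { neighbours = begin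
        q ℕ.* (p ℕ.+ r)           ≡⟨ ℕP.*-distribˡ-+ q p r ⟩
        q ℕ.* p ℕ.+ q ℕ.* r       ≡⟨ cong (q ℕ.* p ℕ.+_) (neighbours br) ⟩
        q ℕ.* p ℕ.+ (p ℕ.* s ℕ.+ 1) ≡⟨ e p q s ⟩
        p ℕ.* (q ℕ.+ s) ℕ.+ 1     ∎
    ; left< = left< br
    ; <right = lt
    }
    where
    open ≡-Reasoning
    e : ∀ p q s → q ℕ.* p ℕ.+ (p ℕ.* s ℕ.+ 1) ≡ p ℕ.* (q ℕ.+ s) ℕ.+ 1
    e = ℕ-Solver.solve-∀

  FareyBracket-right : ∀ {a b p q r s} → FareyBracket a b p q r s → b ℕ.* (p ℕ.+ r) ℕ.< a ℕ.* (q ℕ.+ s) →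
    FareyBracket a b (p ℕ.+ r) (q ℕ.+ s) r s
  FareyBracket-right {p = p} {q} {r} {s} br gt = record
    { neighbours = begin
        (q ℕ.+ s) ℕ.* r           ≡⟨ ℕP.*-distribʳ-+ r q s ⟩
        q ℕ.* r ℕ.+ s ℕ.* r       ≡⟨ cong (ℕ._+ s ℕ.* r) (neighbours br) ⟩
        p ℕ.* s ℕ.+ 1 ℕ.+ s ℕ.* r ≡⟨ e p r s ⟩
        (p ℕ.+ r) ℕ.* s ℕ.+ 1     ∎
    ; left< = gt
    ; <right = <right br
    }
    where
    open ≡-Reasoning
    e : ∀ p r s → p ℕ.* s ℕ.+ 1 ℕ.+ s ℕ.* r ≡ (p ℕ.+ r) ℕ.* s ℕ.+ 1
    e = ℕ-Solver.solve-∀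

  FareyBracket-mediant : ∀ {a b p q r s} → Coprime a b → FareyBracket a b p q r s →
    a ℕ.* (q ℕ.+ s) ≡ b ℕ.* (p ℕ.+ r) → p ℕ.+ r ≡ a × q ℕ.+ s ≡ b
  FareyBracket-mediant {a} {b} {p} {q} {r} {s} coprime br eq = p+r≡a , q+s≡b
    where
    0<p+r : 0 ℕ.< p ℕ.+ r
    0<p+r = ℕP.n≢0⇒n>0 λ p+r≡0 → ℕP.0≢1+n (begin
      0                 ≡⟨ ℕP.*-zeroʳ q ⟨
      q ℕ.* 0           ≡⟨ cong (q ℕ.*_) (ℕP.m+n≡0⇒n≡0 p p+r≡0) ⟨
      q ℕ.* r           ≡⟨ neighbours br ⟩
      p ℕ.* s ℕ.+ 1     ≡⟨ cong (λ v → v ℕ.* s ℕ.+ 1) (ℕP.m+n≡0⇒m≡0 p p+r≡0) ⟩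
      1                 ∎)
      where open ≡-Reasoning
    p+r≡a : p ℕ.+ r ≡ a
    p+r≡a = ℕP.≤-antisym (FareyBracket-numerators br)
      (∣⇒≤ {{ℕ.>-nonZero 0<p+r}} (coprime-divisor coprime (divides (q ℕ.+ s) (trans (sym eq) (ℕP.*-comm a (q ℕ.+ s))))))
    q+s≡b : q ℕ.+ s ≡ b
    q+s≡b = ℕP.*-cancelˡ-≡ (q ℕ.+ s) b a {{ℕ.>-nonZero (subst (0 ℕ.<_) p+r≡a 0<p+r)}}
      (trans eq (trans (cong (b ℕ.*_) p+r≡a) (ℕP.*-comm b a)))

  TropicalMarkov : (ℕ → ℕ → ℤ) → Set
  TropicalMarkov f = ∀ p q r s →
    f (p ℕ.+ (p ℕ.+ r)) (q ℕ.+ (q ℕ.+ s)) ≡ tropicalStep (f p q) (f (p ℕ.+ r) (q ℕ.+ s)) (f r s)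

  TropicalMarkov-right : ∀ {f} → TropicalMarkov f → ∀ p q r s →
    f ((p ℕ.+ r) ℕ.+ r) ((q ℕ.+ s) ℕ.+ s) ≡ tropicalStep (f (p ℕ.+ r) (q ℕ.+ s)) (f r s) (f p q)
  TropicalMarkov-right {f} trop p q r s = begin
    f ((p ℕ.+ r) ℕ.+ r) ((q ℕ.+ s) ℕ.+ s)            ≡⟨ cong₂ f (regroup p r) (regroup q s) ⟩
    f (r ℕ.+ (r ℕ.+ p)) (s ℕ.+ (s ℕ.+ q))            ≡⟨ trop r s p q ⟩
    tropicalStep (f r s) (f (r ℕ.+ p) (s ℕ.+ q)) (f p q)
      ≡⟨ cong (λ v → tropicalStep (f r s) v (f p q)) (cong₂ f (ℕP.+-comm r p) (ℕP.+-comm s q)) ⟩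
    tropicalStep (f r s) (f (p ℕ.+ r) (q ℕ.+ s)) (f p q) ≡⟨ tropicalStep-comm (f r s) (f (p ℕ.+ r) (q ℕ.+ s)) (f p q) ⟩
    tropicalStep (f (p ℕ.+ r) (q ℕ.+ s)) (f r s) (f p q) ∎
    where
    open ≡-Reasoning
    regroup : ∀ p r → (p ℕ.+ r) ℕ.+ r ≡ r ℕ.+ (r ℕ.+ p)
    regroup = ℕ-Solver.solve-∀

  module _ {a b : ℕ} (coprime : Coprime a b) {f : ℕ → ℕ → ℤ} (trop : TropicalMarkov f) where

    private
      fuel-spent : ∀ fuel S {S′ d} → S′ ≡ S ℕ.+ d → 0 ℕ.< d →
        a ℕ.+ b ℕ.< suc fuel ℕ.+ S → a ℕ.+ b ℕ.< fuel ℕ.+ S′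
      fuel-spent fuel S {d = d} refl 0<d ok =
        ℕP.<-≤-trans ok (subst (ℕ._≤ fuel ℕ.+ (S ℕ.+ d)) (e fuel S) (ℕP.+-monoʳ-≤ fuel (ℕP.+-monoʳ-≤ S 0<d)))
        where e : ∀ fuel S → fuel ℕ.+ (S ℕ.+ 1) ≡ suc fuel ℕ.+ S
              e = ℕ-Solver.solve-∀

    markovWalk-order : ∀ fuel {p q r s} {X Y Z : ℚ → ℚ} → FareyBracket a b p q r s →
      a ℕ.+ b ℕ.< fuel ℕ.+ ((p ℕ.+ q) ℕ.+ (r ℕ.+ s)) →
      HasOrder X (f p q) → HasOrder Y (f (p ℕ.+ r) (q ℕ.+ s)) → HasOrder Z (f r s) →
      HasOrder (λ t → markovWalk a b fuel p q r s (X t) (Y t) (Z t)) (f a b)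
    markovWalk-order zero {p} {q} {r} {s} br ok _ _ _ = ⊥-elim (ℕP.<⇒≱ ok
      (subst (ℕ._≤ a ℕ.+ b) (regroup p q r s)
        (ℕP.+-mono-≤ (FareyBracket-numerators br) (FareyBracket-denominators br))))
      where regroup : ∀ p q r s → (p ℕ.+ r) ℕ.+ (q ℕ.+ s) ≡ (p ℕ.+ q) ℕ.+ (r ℕ.+ s)
            regroup = ℕ-Solver.solve-∀
    markovWalk-order (suc fuel) {p} {q} {r} {s} {X} {Y} {Z} br ok oX oY oZ
      with ℕP.<-cmp (a ℕ.* (q ℕ.+ s)) (b ℕ.* (p ℕ.+ r))
    ... | tri< lt _ _ = markovWalk-order fuel (FareyBracket-left br lt)
                          (fuel-spent fuel _ (regroupˡ p q r s) (ℕP.<-≤-trans (FareyBracket-den>0 br) (ℕP.m≤n+m q p)) ok) oX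
                          (subst (HasOrder (λ t → (X t ^ 2 + Y t ^ 2) ⊘ Z t)) (sym (trop p q r s)) (HasOrder-step oX oY oZ)) oY
      where regroupˡ : ∀ p q r s → (p ℕ.+ q) ℕ.+ ((p ℕ.+ r) ℕ.+ (q ℕ.+ s)) ≡ ((p ℕ.+ q) ℕ.+ (r ℕ.+ s)) ℕ.+ (p ℕ.+ q)
            regroupˡ = ℕ-Solver.solve-∀
    ... | tri≈ _ eq _ = subst (HasOrder Y) (uncurry (cong₂ f) (FareyBracket-mediant coprime br eq)) oY
    ... | tri> _ _ gt = markovWalk-order fuel (FareyBracket-right br gt)
                          (fuel-spent fuel _ (regroupʳ p q r s)
                             (ℕP.<-≤-trans (FareyBracket-den>0 (FareyBracket-mirror br)) (ℕP.m≤m+n r s)) ok) oY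
                          (subst (HasOrder (λ t → (Y t ^ 2 + Z t ^ 2) ⊘ X t)) (sym (TropicalMarkov-right {f} trop p q r s))
                                 (HasOrder-step oY oZ oX)) oZ
      where regroupʳ : ∀ p q r s → ((p ℕ.+ r) ℕ.+ (q ℕ.+ s)) ℕ.+ (r ℕ.+ s) ≡ ((p ℕ.+ q) ℕ.+ (r ℕ.+ s)) ℕ.+ (r ℕ.+ s)
            regroupʳ = ℕ-Solver.solve-∀

    markov-order : 1 ℕ.≤ a → 1 ℕ.≤ b → ∀ α β γ →
      f 0 1 ≡ + α → f 1 0 ≡ + β → f 1 1 ≡ tropicalStep (+ α) (+ β) (+ γ) →
      HasOrder (λ t → markov a b (t ^ α) (t ^ β) (t ^ γ)) (f a b)
    markov-order 1≤a 1≤b α β γ f01 f10 f11 =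
      markovWalk-order (a ℕ.+ b) start (ℕP.m<m+n (a ℕ.+ b) (s≤s z≤n))
        (subst (HasOrder (λ t → t ^ α)) (sym f01) (HasOrder-pow α))
        (subst (HasOrder (λ t → ((t ^ α) ^ 2 + (t ^ β) ^ 2) ⊘ (t ^ γ))) (sym f11)
               (HasOrder-step (HasOrder-pow α) (HasOrder-pow β) (HasOrder-pow γ)))
        (subst (HasOrder (λ t → t ^ β)) (sym f10) (HasOrder-pow β))
      where
      start : FareyBracket a b 0 1 1 0
      start = record
        { neighbours = refl
        ; left< = subst₂ ℕ._<_ (sym (ℕP.*-zeroʳ b)) (sym (ℕP.*-identityʳ a)) 1≤a
        ; <right = subst₂ ℕ._<_ (sym (ℕP.*-zeroʳ a)) (sym (ℕP.*-identityʳ b)) 1≤b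
        }

  -- Solutions of the tropical Markov recursion

  abs : ℤ → ℤ
  abs i = + ℤ.∣ i ∣

  abs-neg : ∀ i → abs (ℤ.- i) ≡ abs i
  abs-neg i = cong +_ (ℤP.∣-i∣≡∣i∣ i)

  abs-nonPos : ∀ {i} → i ℤ.≤ 0ℤ → abs i ≡ ℤ.- i
  abs-nonPos {i} i≤0 = trans (sym (abs-neg i)) (ℤP.0≤i⇒+∣i∣≡i (ℤP.neg-mono-≤ i≤0))

  i≤abs : ∀ i → i ℤ.≤ abs i
  i≤abs (+ n) = ℤP.≤-refl
  i≤abs ℤ.-[1+ n ] = ℤ.-≤+

  -i≤abs : ∀ i → ℤ.- i ℤ.≤ abs i
  -i≤abs i = subst (ℤ.- i ℤ.≤_) (abs-neg i) (i≤abs (ℤ.- i))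

  abs-sum-diff-nonNeg : ∀ {x y} → 0ℤ ℤ.≤ x → abs y ℤ.≤ x → abs (x ℤ.+ y) ℤ.+ abs (y ℤ.- x) ≡ x ℤ.+ x
  abs-sum-diff-nonNeg {x} {y} 0≤x |y|≤x = begin
    abs (x ℤ.+ y) ℤ.+ abs (y ℤ.- x)     ≡⟨ cong₂ ℤ._+_ (ℤP.0≤i⇒+∣i∣≡i 0≤x+y) (abs-nonPos y-x≤0) ⟩
    (x ℤ.+ y) ℤ.+ ℤ.- (y ℤ.- x)         ≡⟨ cancel x y ⟩
    x ℤ.+ x                             ∎
    where
    open ≡-Reasoning
    0≤x+y : 0ℤ ℤ.≤ x ℤ.+ y
    0≤x+y = subst (0ℤ ℤ.≤_) (cong (λ v → x ℤ.+ v) (ℤP.neg-involutive y))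
              (ℤP.i≤j⇒0≤j-i (ℤP.≤-trans (-i≤abs y) |y|≤x))
    y-x≤0 : y ℤ.- x ℤ.≤ 0ℤ
    y-x≤0 = ℤP.i≤j⇒i-j≤0 (ℤP.≤-trans (i≤abs y) |y|≤x)
    cancel : ∀ x y → (x ℤ.+ y) ℤ.+ ℤ.- (y ℤ.- x) ≡ x ℤ.+ x
    cancel = ℤ-Solver.solve-∀

  abs-sum-diff : ∀ x y → abs y ℤ.≤ abs x → abs (x ℤ.+ y) ℤ.+ abs (y ℤ.- x) ≡ abs x ℤ.+ abs x
  abs-sum-diff x y |y|≤|x| with ℤP.≤-total 0ℤ x
  ... | inj₁ 0≤x = trans (abs-sum-diff-nonNeg 0≤x (subst (abs y ℤ.≤_) (ℤP.0≤i⇒+∣i∣≡i 0≤x) |y|≤|x|))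
                         (cong (λ v → v ℤ.+ v) (sym (ℤP.0≤i⇒+∣i∣≡i 0≤x)))
  ... | inj₂ x≤0 = begin
    abs (x ℤ.+ y) ℤ.+ abs (y ℤ.- x)
      ≡⟨ cong₂ ℤ._+_ (sym (trans (cong abs (neg-sum x y)) (abs-neg (x ℤ.+ y))))
                     (sym (trans (cong abs (neg-diff x y)) (abs-neg (y ℤ.- x)))) ⟩
    abs (ℤ.- x ℤ.+ ℤ.- y) ℤ.+ abs (ℤ.- y ℤ.- ℤ.- x)
      ≡⟨ abs-sum-diff-nonNeg (ℤP.neg-mono-≤ x≤0)
           (subst₂ ℤ._≤_ (sym (abs-neg y)) (abs-nonPos x≤0) |y|≤|x|) ⟩
    ℤ.- x ℤ.+ ℤ.- x
      ≡⟨ cong (λ v → v ℤ.+ v) (sym (abs-nonPos x≤0)) ⟩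
    abs x ℤ.+ abs x ∎
    where
    open ≡-Reasoning
    neg-sum : ∀ x y → ℤ.- x ℤ.+ ℤ.- y ≡ ℤ.- (x ℤ.+ y)
    neg-sum = ℤ-Solver.solve-∀
    neg-diff : ∀ x y → ℤ.- y ℤ.- ℤ.- x ≡ ℤ.- (y ℤ.- x)
    neg-diff = ℤ-Solver.solve-∀

  private
    double-antitone : ∀ c {u v} → u ℤ.≤ v → (c ℤ.- v) ℤ.+ (c ℤ.- v) ℤ.≤ (c ℤ.- u) ℤ.+ (c ℤ.- u)
    double-antitone c u≤v = ℤP.+-mono-≤ c-v≤c-u c-v≤c-u
      where c-v≤c-u = ℤP.+-monoʳ-≤ c (ℤP.neg-mono-≤ u≤v)

    solve-for-P : ∀ c P Q R → P ℤ.+ Q ≡ R ℤ.+ R → c ℤ.- P ≡ ((c ℤ.- R) ℤ.+ (c ℤ.- R)) ℤ.- (c ℤ.- Q)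
    solve-for-P c P Q R P+Q≡2R = trans (cong (λ v → c ℤ.- v) (trans (isolate P Q) (cong (ℤ._- Q) P+Q≡2R))) (regroup c Q R)
      where
      isolate : ∀ P Q → P ≡ (P ℤ.+ Q) ℤ.- Q
      isolate = ℤ-Solver.solve-∀
      regroup : ∀ c Q R → c ℤ.- ((R ℤ.+ R) ℤ.- Q) ≡ ((c ℤ.- R) ℤ.+ (c ℤ.- R)) ℤ.- (c ℤ.- Q)
      regroup = ℤ-Solver.solve-∀

  tropicalStep-abs : ∀ c X Y → c ℤ.- abs (X ℤ.+ Y) ≡ tropicalStep (c ℤ.- abs X) (c ℤ.- abs Y) (c ℤ.- abs (Y ℤ.- X))
  tropicalStep-abs c X Y with ℤP.≤-total (abs X) (abs Y)
  ... | inj₁ |X|≤|Y| = trans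
    (solve-for-P c _ _ (abs Y) (trans (cong₂ ℤ._+_ (cong abs (ℤP.+-comm X Y)) (abs-swap X Y)) (abs-sum-diff Y X |X|≤|Y|)))
    (cong (ℤ._- (c ℤ.- abs (Y ℤ.- X))) (sym (ℤP.i≥j⇒i⊓j≡j (double-antitone c |X|≤|Y|))))
    where
    abs-swap : ∀ X Y → abs (Y ℤ.- X) ≡ abs (X ℤ.- Y)
    abs-swap X Y = trans (cong abs (swap X Y)) (abs-neg (X ℤ.- Y))
      where swap : ∀ X Y → Y ℤ.- X ≡ ℤ.- (X ℤ.- Y)
            swap = ℤ-Solver.solve-∀
  ... | inj₂ |Y|≤|X| = trans
    (solve-for-P c _ _ (abs X) (abs-sum-diff X Y |Y|≤|X|))
    (cong (ℤ._- (c ℤ.- abs (Y ℤ.- X))) (sym (ℤP.i≤j⇒i⊓j≡i (double-antitone c |Y|≤|X|))))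

  linear : ℤ → ℤ → ℕ → ℕ → ℤ
  linear μ ν p q = μ ℤ.* + p ℤ.+ ν ℤ.* + q

  linear-+ : ∀ μ ν p q r s → linear μ ν (p ℕ.+ r) (q ℕ.+ s) ≡ linear μ ν p q ℤ.+ linear μ ν r s
  linear-+ μ ν p q r s =
    trans (cong₂ (λ u v → μ ℤ.* u ℤ.+ ν ℤ.* v) (ℤP.pos-+ p r) (ℤP.pos-+ q s)) (distrib μ ν (+ p) (+ q) (+ r) (+ s))
    where distrib : ∀ μ ν p q r s → μ ℤ.* (p ℤ.+ r) ℤ.+ ν ℤ.* (q ℤ.+ s) ≡ (μ ℤ.* p ℤ.+ ν ℤ.* q) ℤ.+ (μ ℤ.* r ℤ.+ ν ℤ.* s)
          distrib = ℤ-Solver.solve-∀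

  absLinear : ℤ → ℤ → ℤ → ℕ → ℕ → ℤ
  absLinear c μ ν p q = c ℤ.- abs (linear μ ν p q)

  absLinear-tropical : ∀ c μ ν → TropicalMarkov (absLinear c μ ν)
  absLinear-tropical c μ ν p q r s = begin
    c ℤ.- abs (L (p ℕ.+ (p ℕ.+ r)) (q ℕ.+ (q ℕ.+ s)))  ≡⟨ cong (λ v → c ℤ.- abs v) (linear-+ μ ν p q (p ℕ.+ r) (q ℕ.+ s)) ⟩
    c ℤ.- abs (X ℤ.+ Y)                                ≡⟨ tropicalStep-abs c X Y ⟩
    tropicalStep (c ℤ.- abs X) (c ℤ.- abs Y) (c ℤ.- abs (Y ℤ.- X))
      ≡⟨ cong (λ v → tropicalStep (c ℤ.- abs X) (c ℤ.- abs Y) (c ℤ.- abs v)) Y-X≡L[r,s] ⟩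
    tropicalStep (c ℤ.- abs X) (c ℤ.- abs Y) (c ℤ.- abs (L r s)) ∎
    where
    open ≡-Reasoning
    L = linear μ ν
    X = L p q
    Y = L (p ℕ.+ r) (q ℕ.+ s)
    Y-X≡L[r,s] : Y ℤ.- X ≡ L r s
    Y-X≡L[r,s] = trans (cong (ℤ._- X) (linear-+ μ ν p q r s)) (cancel X (L r s))
      where cancel : ∀ x y → (x ℤ.+ y) ℤ.- x ≡ y
            cancel = ℤ-Solver.solve-∀

  linear-pos : ∀ μ ν p q → linear (+ μ) (+ ν) p q ≡ + (μ ℕ.* p ℕ.+ ν ℕ.* q)
  linear-pos μ ν p q = sym (trans (ℤP.pos-+ (μ ℕ.* p) (ν ℕ.* q)) (cong₂ ℤ._+_ (ℤP.pos-* μ p) (ℤP.pos-* ν q)))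

  linear-pos-neg : ∀ μ ν p q → linear (+ μ) (ℤ.- + ν) p q ≡ + (μ ℕ.* p) ℤ.- + (ν ℕ.* q)
  linear-pos-neg μ ν p q = trans (negate (+ μ) (+ ν) (+ p) (+ q)) (sym (cong₂ ℤ._-_ (ℤP.pos-* μ p) (ℤP.pos-* ν q)))
    where negate : ∀ μ ν p q → μ ℤ.* p ℤ.+ ℤ.- ν ℤ.* q ≡ μ ℤ.* p ℤ.- ν ℤ.* q
          negate = ℤ-Solver.solve-∀

  -- Coefficients of sums of powers of t

  private
    below : ∀ {n} {P : ℕ → Set} → (∀ i → i ℕ.≤ suc n → P i) → ∀ i → i ℕ.≤ n → P i
    below h i i≤n = h i (ℕP.m≤n⇒m≤1+n i≤n)

  sumTo-cong : ∀ n {f g : ℕ → ℚ} → (∀ i → i ℕ.≤ n → f i ≡ g i) → sumTo n f ≡ sumTo n g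
  sumTo-cong zero f≗g = f≗g 0 ℕ.z≤n
  sumTo-cong (suc n) f≗g = cong₂ _+_ (sumTo-cong n (below f≗g)) (f≗g (suc n) ℕP.≤-refl)

  sumTo-mono : ∀ n {f g : ℕ → ℚ} → (∀ i → i ℕ.≤ n → f i ≤ g i) → sumTo n f ≤ sumTo n g
  sumTo-mono zero f≤g = f≤g 0 ℕ.z≤n
  sumTo-mono (suc n) f≤g = ℚP.+-mono-≤ (sumTo-mono n (below f≤g)) (f≤g (suc n) ℕP.≤-refl)

  sumTo-zero : ∀ n → sumTo n (λ _ → 0ℚ) ≡ 0ℚ
  sumTo-zero zero = refl
  sumTo-zero (suc n) = cong (_+ 0ℚ) (sumTo-zero n)

  sumTo-nonNeg : ∀ n {f : ℕ → ℚ} → (∀ i → i ℕ.≤ n → 0ℚ ≤ f i) → 0ℚ ≤ sumTo n f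
  sumTo-nonNeg n {f} 0≤f = subst (_≤ sumTo n f) (sumTo-zero n) (sumTo-mono n 0≤f)

  sumTo-sub : ∀ n (f g : ℕ → ℚ) → sumTo n (λ i → f i - g i) ≡ sumTo n f - sumTo n g
  sumTo-sub zero f g = refl
  sumTo-sub (suc n) f g =
    trans (cong (_+ (f (suc n) - g (suc n))) (sumTo-sub n f g)) (regroup (sumTo n f) (sumTo n g) (f (suc n)) (g (suc n)))
    where regroup : ∀ a b c d → (a - b) + (c - d) ≡ (a + c) - (b + d)
          regroup = solve 4 (λ a b c d → (a :- b) :+ (c :- d) := (a :+ c) :- (b :+ d)) refl

  sumTo-*ʳ : ∀ n (f : ℕ → ℚ) c → sumTo n (λ i → f i * c) ≡ sumTo n f * c
  sumTo-*ʳ zero f c = refl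
  sumTo-*ʳ (suc n) f c = trans (cong (_+ f (suc n) * c) (sumTo-*ʳ n f c)) (sym (ℚP.*-distribʳ-+ c (sumTo n f) (f (suc n))))

  sumTo-abs : ∀ n (f : ℕ → ℚ) → ∣ sumTo n f ∣ ≤ sumTo n (λ i → ∣ f i ∣)
  sumTo-abs zero f = ℚP.≤-refl
  sumTo-abs (suc n) f = ℚP.≤-trans (ℚP.∣p+q∣≤∣p∣+∣q∣ (sumTo n f) (f (suc n))) (ℚP.+-monoˡ-≤ ∣ f (suc n) ∣ (sumTo-abs n f))

  δ : ℕ → ℕ → ℚ → ℚ
  δ k i v with i ℕ.≟ k
  ... | yes _ = v
  ... | no _ = 0ℚ

  δ-at : ∀ k v → δ k k v ≡ v
  δ-at k v with k ℕ.≟ k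
  ... | yes _ = refl
  ... | no k≢k = ⊥-elim (k≢k refl)

  δ-off : ∀ {k i} v → i ≢ k → δ k i v ≡ 0ℚ
  δ-off {k} {i} v i≢k with i ℕ.≟ k
  ... | yes i≡k = ⊥-elim (i≢k i≡k)
  ... | no _ = refl

  sumTo-δ : ∀ n {k} v → k ℕ.≤ n → sumTo n (λ i → δ k i v) ≡ v
  sumTo-δ zero {zero} v _ = δ-at 0 v
  sumTo-δ (suc n) {k} v k≤1+n with k ℕ.≟ suc n
  ... | yes refl = trans (cong₂ _+_ (trans (sumTo-cong n (λ i i≤n → δ-off v (ℕP.<⇒≢ (ℕ.s≤s i≤n)))) (sumTo-zero n))
                                    (δ-at (suc n) v))
                         (ℚP.+-identityˡ v)
  ... | no k≢1+n = trans (cong₂ _+_ (sumTo-δ n v (ℕP.≤-pred (ℕP.≤∧≢⇒< k≤1+n k≢1+n))) (δ-off v (k≢1+n ∘ sym)))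
                         (ℚP.+-identityʳ v)

  Σ△ : ℕ → (ℕ → ℕ → ℚ) → ℚ
  Σ△ n F = sumTo n (λ i → sumTo (n ∸ i) (F i))

  private
    △-index : ∀ {n i j} → i ℕ.≤ n → j ℕ.≤ n ∸ i → i ℕ.+ j ℕ.≤ n
    △-index {n} {i} {j} i≤n j≤n-i = subst (i ℕ.+ j ℕ.≤_) (ℕP.m+[n∸m]≡n i≤n) (ℕP.+-monoʳ-≤ i j≤n-i)

    △-index⁻¹ : ∀ {n i j} → i ℕ.+ j ℕ.≤ n → j ℕ.≤ n ∸ i
    △-index⁻¹ {n} {i} {j} i+j≤n = subst (ℕ._≤ n ∸ i) (ℕP.m+n∸m≡n i j) (ℕP.∸-monoˡ-≤ i i+j≤n)

  Σ△-cong : ∀ n {F G : ℕ → ℕ → ℚ} → (∀ i j → i ℕ.+ j ℕ.≤ n → F i j ≡ G i j) → Σ△ n F ≡ Σ△ n G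
  Σ△-cong n F≗G = sumTo-cong n (λ i i≤n → sumTo-cong (n ∸ i) (λ j j≤ → F≗G i j (△-index i≤n j≤)))

  Σ△-mono : ∀ n {F G : ℕ → ℕ → ℚ} → (∀ i j → i ℕ.+ j ℕ.≤ n → F i j ≤ G i j) → Σ△ n F ≤ Σ△ n G
  Σ△-mono n F≤G = sumTo-mono n (λ i i≤n → sumTo-mono (n ∸ i) (λ j j≤ → F≤G i j (△-index i≤n j≤)))

  Σ△-nonNeg : ∀ n {F : ℕ → ℕ → ℚ} → (∀ i j → i ℕ.+ j ℕ.≤ n → 0ℚ ≤ F i j) → 0ℚ ≤ Σ△ n F
  Σ△-nonNeg n 0≤F = sumTo-nonNeg n (λ i i≤n → sumTo-nonNeg (n ∸ i) (λ j j≤ → 0≤F i j (△-index i≤n j≤)))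

  Σ△-abs : ∀ n (F : ℕ → ℕ → ℚ) → ∣ Σ△ n F ∣ ≤ Σ△ n (λ i j → ∣ F i j ∣)
  Σ△-abs n F = ℚP.≤-trans (sumTo-abs n _) (sumTo-mono n (λ i _ → sumTo-abs (n ∸ i) (F i)))

  Σ△-sub : ∀ n (F G : ℕ → ℕ → ℚ) → Σ△ n (λ i j → F i j - G i j) ≡ Σ△ n F - Σ△ n G
  Σ△-sub n F G = trans (sumTo-cong n (λ i _ → sumTo-sub (n ∸ i) (F i) (G i))) (sumTo-sub n _ _)

  Σ△-*ʳ : ∀ n (F : ℕ → ℕ → ℚ) c → Σ△ n (λ i j → F i j * c) ≡ Σ△ n F * c
  Σ△-*ʳ n F c = trans (sumTo-cong n (λ i _ → sumTo-*ʳ (n ∸ i) (F i) c)) (sumTo-*ʳ n _ c)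

  Σ△-δ : ∀ n {i₀ j₀} v → i₀ ℕ.+ j₀ ℕ.≤ n → Σ△ n (λ i j → δ i₀ i (δ j₀ j v)) ≡ v
  Σ△-δ n {i₀} {j₀} v i₀+j₀≤n =
    trans (sumTo-cong n row) (sumTo-δ n v (ℕP.≤-trans (ℕP.m≤m+n i₀ j₀) i₀+j₀≤n))
    where
    row : ∀ i → i ℕ.≤ n → sumTo (n ∸ i) (λ j → δ i₀ i (δ j₀ j v)) ≡ δ i₀ i v
    row i _ with i ℕ.≟ i₀
    ... | yes refl = sumTo-δ (n ∸ i) v (△-index⁻¹ i₀+j₀≤n)
    ... | no _ = sumTo-zero (n ∸ i)

  no-small-domination : ∀ {a K m} → 0ℚ < a → 0ℚ ≤ K →
    (∀ {t} → 0ℚ < t → t ≤ 1ℚ → a * t ^ m ≤ (K * t) * t ^ m) → ⊥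
  no-small-domination {m = m} 0<a 0≤K dominated with ∃-small 0<a 0≤K
  ... | t , 0<t , t≤1 , Kt<a =
    ℚP.<-irrefl refl (ℚP.≤-<-trans (*-cancelʳ-≤ (^-pos m 0<t) (dominated 0<t t≤1)) Kt<a)

  module Extraction (n : ℕ) (A : ℕ → ℕ → ℚ) (w : ℕ → ℕ → ℕ) where

    S : ℚ → ℚ
    S t = Σ△ n (λ i j → A i j * t ^ w i j)

    ‖A‖ : ℚ
    ‖A‖ = Σ△ n (λ i j → ∣ A i j ∣)

    ‖A‖-nonNeg : 0ℚ ≤ ‖A‖
    ‖A‖-nonNeg = Σ△-nonNeg n (λ i j _ → ℚP.0≤∣p∣ (A i j))

    Isolated : ℕ → ℕ → ℕ → Set
    Isolated i₀ j₀ m = ∀ i j → i ℕ.+ j ℕ.≤ n → (i , j) ≢ (i₀ , j₀) → A i j ≡ 0ℚ ⊎ m ℕ.< w i j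

    leading-term : ∀ {i₀ j₀ m t} → i₀ ℕ.+ j₀ ℕ.≤ n → w i₀ j₀ ≡ m → Isolated i₀ j₀ m → 0ℚ < t → t ≤ 1ℚ →
      ∣ S t - A i₀ j₀ * t ^ m ∣ ≤ ‖A‖ * t ^ suc m
    leading-term {i₀} {j₀} {m} {t} in△ w≡m isolated 0<t t≤1 = begin
      ∣ S t - A₀t^m ∣
        ≡⟨ cong ∣_∣ (trans (Σ△-sub n _ _) (cong (λ v → S t - v) (Σ△-δ n A₀t^m in△))) ⟨
      ∣ Σ△ n (λ i j → A i j * t ^ w i j - δ i₀ i (δ j₀ j A₀t^m)) ∣
        ≤⟨ Σ△-abs n _ ⟩
      Σ△ n (λ i j → ∣ A i j * t ^ w i j - δ i₀ i (δ j₀ j A₀t^m) ∣)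
        ≤⟨ Σ△-mono n term ⟩
      Σ△ n (λ i j → ∣ A i j ∣ * t ^ suc m)
        ≡⟨ Σ△-*ʳ n _ _ ⟩
      ‖A‖ * t ^ suc m ∎
      where
      open ℚP.≤-Reasoning
      A₀t^m = A i₀ j₀ * t ^ m
      0≤t = ℚP.<⇒≤ 0<t
      bound-nonNeg : ∀ i j → 0ℚ ≤ ∣ A i j ∣ * t ^ suc m
      bound-nonNeg i j = *-nonNeg (ℚP.0≤∣p∣ (A i j)) (^-nonNeg (suc m) 0≤t)
      other : ∀ i j → i ℕ.+ j ℕ.≤ n → (i , j) ≢ (i₀ , j₀) → ∣ A i j * t ^ w i j - 0ℚ ∣ ≤ ∣ A i j ∣ * t ^ suc m
      other i j i+j≤n ij≢ with isolated i j i+j≤n ij≢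
      ... | inj₁ Aij≡0 = subst (_≤ ∣ A i j ∣ * t ^ suc m)
                           (cong ∣_∣ (sym (trans (ℚP.+-identityʳ _) (trans (cong (_* t ^ w i j) Aij≡0) (ℚP.*-zeroˡ (t ^ w i j))))))
                           (bound-nonNeg i j)
      ... | inj₂ m<w = begin
        ∣ A i j * t ^ w i j - 0ℚ ∣    ≡⟨ cong ∣_∣ (ℚP.+-identityʳ _) ⟩
        ∣ A i j * t ^ w i j ∣         ≡⟨ ℚP.∣p*q∣≡∣p∣*∣q∣ (A i j) (t ^ w i j) ⟩
        ∣ A i j ∣ * ∣ t ^ w i j ∣     ≡⟨ cong (∣ A i j ∣ *_) (ℚP.0≤p⇒∣p∣≡p (^-nonNeg (w i j) 0≤t)) ⟩
        ∣ A i j ∣ * t ^ w i j         ≤⟨ *-monoˡ-≤ (ℚP.0≤∣p∣ (A i j)) (^-antimono 0≤t t≤1 m<w) ⟩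
        ∣ A i j ∣ * t ^ suc m         ∎
      term : ∀ i j → i ℕ.+ j ℕ.≤ n → ∣ A i j * t ^ w i j - δ i₀ i (δ j₀ j A₀t^m) ∣ ≤ ∣ A i j ∣ * t ^ suc m
      term i j i+j≤n with i ℕ.≟ i₀ | j ℕ.≟ j₀
      ... | yes refl | yes refl = subst (_≤ ∣ A i j ∣ * t ^ suc m) (cong ∣_∣ (sym cancels)) (bound-nonNeg i j)
        where
        cancels : A i j * t ^ w i j - A₀t^m ≡ 0ℚ
        cancels = trans (cong (λ e → A i j * t ^ e - A₀t^m) w≡m) (ℚP.+-inverseʳ A₀t^m)
      ... | yes refl | no j≢j₀ = other i j i+j≤n (λ eq → j≢j₀ (cong proj₂ eq))
      ... | no i≢i₀ | _ = other i j i+j≤n (λ eq → i≢i₀ (cong proj₁ eq))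

    isolated-zero : ∀ {i₀ j₀ m E C} → i₀ ℕ.+ j₀ ℕ.≤ n → w i₀ j₀ ≡ m → Isolated i₀ j₀ m → m ℕ.< E → 0ℚ ≤ C →
      (∀ {t} → 0ℚ < t → t ≤ 1ℚ → ∣ S t ∣ ≤ C * t ^ E) → A i₀ j₀ ≡ 0ℚ
    isolated-zero {i₀} {j₀} {m} {E} {C} in△ w≡m isolated m<E 0≤C S-small with A i₀ j₀ ℚP.≟ 0ℚ
    ... | yes A₀≡0 = A₀≡0
    ... | no A₀≢0 = ⊥-elim (no-small-domination {m = m} (∣p∣-pos A₀≢0) (+-nonNeg 0≤C ‖A‖-nonNeg) dominated)
      where
      ∣p∣-pos : ∀ {p} → p ≢ 0ℚ → 0ℚ < ∣ p ∣
      ∣p∣-pos {p} p≢0 with ℚP.<-cmp 0ℚ ∣ p ∣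
      ... | tri< 0<∣p∣ _ _ = 0<∣p∣
      ... | tri≈ _ 0≡∣p∣ _ = ⊥-elim (p≢0 (ℚP.∣p∣≡0⇒p≡0 p (sym 0≡∣p∣)))
      ... | tri> _ _ ∣p∣<0 = ⊥-elim (ℚP.<-irrefl refl (ℚP.<-≤-trans ∣p∣<0 (ℚP.0≤∣p∣ p)))
      dominated : ∀ {t} → 0ℚ < t → t ≤ 1ℚ → ∣ A i₀ j₀ ∣ * t ^ m ≤ ((C + ‖A‖) * t) * t ^ m
      dominated {t} 0<t t≤1 = begin
        ∣ A i₀ j₀ ∣ * t ^ m                   ≡⟨ cong (∣ A i₀ j₀ ∣ *_) (ℚP.0≤p⇒∣p∣≡p (^-nonNeg m 0≤t)) ⟨
        ∣ A i₀ j₀ ∣ * ∣ t ^ m ∣               ≡⟨ ℚP.∣p*q∣≡∣p∣*∣q∣ (A i₀ j₀) (t ^ m) ⟨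
        ∣ A i₀ j₀ * t ^ m ∣                   ≡⟨ cong ∣_∣ (difference (S t) (A i₀ j₀ * t ^ m)) ⟩
        ∣ S t - (S t - A i₀ j₀ * t ^ m) ∣     ≤⟨ ℚP.∣p-q∣≤∣p∣+∣q∣ (S t) _ ⟩
        ∣ S t ∣ + ∣ S t - A i₀ j₀ * t ^ m ∣   ≤⟨ ℚP.+-mono-≤ (S-small 0<t t≤1) (leading-term in△ w≡m isolated 0<t t≤1) ⟩
        C * t ^ E + ‖A‖ * t ^ suc m           ≤⟨ ℚP.+-monoˡ-≤ (‖A‖ * t ^ suc m) (*-monoˡ-≤ 0≤C (^-antimono 0≤t t≤1 m<E)) ⟩
        C * t ^ suc m + ‖A‖ * t ^ suc m       ≡⟨ regroup C ‖A‖ t (t ^ m) ⟩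
        ((C + ‖A‖) * t) * t ^ m               ∎
        where
        open ℚP.≤-Reasoning
        0≤t = ℚP.<⇒≤ 0<t
        difference : ∀ x y → y ≡ x - (x - y)
        difference = solve 2 (λ x y → y := x :- (x :- y)) refl
        regroup : ∀ C D t u → C * (t * u) + D * (t * u) ≡ ((C + D) * t) * u
        regroup = solve 4 (λ C D t u → C :* (t :* u) :+ D :* (t :* u) := ((C :+ D) :* t) :* u) refl

    isolated-nonzero : ∀ {i₀ j₀ m c} → i₀ ℕ.+ j₀ ℕ.≤ n → w i₀ j₀ ≡ m → Isolated i₀ j₀ m → 0ℚ < c →
      (∀ {t} → 0ℚ < t → t ≤ 1ℚ → c * t ^ m ≤ S t) → A i₀ j₀ ≢ 0ℚ
    isolated-nonzero {i₀} {j₀} {m} {c} in△ w≡m isolated 0<c S-large A₀≡0 =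
      no-small-domination {m = m} 0<c ‖A‖-nonNeg dominated
      where
      dominated : ∀ {t} → 0ℚ < t → t ≤ 1ℚ → c * t ^ m ≤ (‖A‖ * t) * t ^ m
      dominated {t} 0<t t≤1 = begin
        c * t ^ m                        ≤⟨ S-large 0<t t≤1 ⟩
        S t                              ≤⟨ p≤∣p∣ (S t) ⟩
        ∣ S t ∣                          ≡⟨ cong ∣_∣ (drop-zero (S t) (t ^ m)) ⟨
        ∣ S t - 0ℚ * t ^ m ∣             ≡⟨ cong (λ a → ∣ S t - a * t ^ m ∣) A₀≡0 ⟨
        ∣ S t - A i₀ j₀ * t ^ m ∣        ≤⟨ leading-term in△ w≡m isolated 0<t t≤1 ⟩
        ‖A‖ * t ^ suc m                  ≡⟨ ℚP.*-assoc ‖A‖ t (t ^ m) ⟨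
        (‖A‖ * t) * t ^ m                ∎
        where
        open ℚP.≤-Reasoning
        p≤∣p∣ : ∀ p → p ≤ ∣ p ∣
        p≤∣p∣ p with ℚP.≤-total 0ℚ p
        ... | inj₁ 0≤p = ℚP.≤-reflexive (sym (ℚP.0≤p⇒∣p∣≡p 0≤p))
        ... | inj₂ p≤0 = ℚP.≤-trans p≤0 (ℚP.0≤∣p∣ p)
        drop-zero : ∀ x u → x - 0ℚ * u ≡ x
        drop-zero = solve 2 (λ x u → x :- con 0ℚ :* u := x) refl

    InjectiveOn△ : Set
    InjectiveOn△ = ∀ {i j i′ j′} → i ℕ.+ j ℕ.≤ n → i′ ℕ.+ j′ ℕ.≤ n → w i j ≡ w i′ j′ → (i , j) ≡ (i′ , j′)

    module ByWeight (injective : InjectiveOn△) {E C} (0≤C : 0ℚ ≤ C)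
             (S-small : ∀ {t} → 0ℚ < t → t ≤ 1ℚ → ∣ S t ∣ ≤ C * t ^ E) where

      isolated-by-weight : ∀ {i₀ j₀ m} → i₀ ℕ.+ j₀ ℕ.≤ n → w i₀ j₀ ≡ m →
        (∀ i j → i ℕ.+ j ℕ.≤ n → w i j ℕ.< m → A i j ≡ 0ℚ) → Isolated i₀ j₀ m
      isolated-by-weight {m = m} in△ w≡m lighter-vanish i j i+j≤n ij≢ with ℕP.<-cmp (w i j) m
      ... | tri< w<m _ _ = inj₁ (lighter-vanish i j i+j≤n w<m)
      ... | tri≈ _ w≡ _ = ⊥-elim (ij≢ (injective i+j≤n in△ (trans w≡ (sym w≡m))))
      ... | tri> _ _ m<w = inj₂ m<w

      lighter-vanish : ∀ m → m ℕ.≤ E → ∀ i j → i ℕ.+ j ℕ.≤ n → w i j ℕ.< m → A i j ≡ 0ℚ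
      lighter-vanish (suc m) 1+m≤E i j i+j≤n w<1+m with ℕP.m≤n⇒m<n∨m≡n (ℕP.≤-pred w<1+m)
      ... | inj₁ w<m = lighter-vanish m (ℕP.<⇒≤ 1+m≤E) i j i+j≤n w<m
      ... | inj₂ w≡m = isolated-zero i+j≤n w≡m
                         (isolated-by-weight i+j≤n w≡m (lighter-vanish m (ℕP.<⇒≤ 1+m≤E))) 1+m≤E 0≤C S-small

  -- Monomial substitutions into the Markov polynomial

  sum-minus-abs-diff : ∀ x y → (x ℤ.+ y) ℤ.- abs (x ℤ.- y) ≡ (x ℤ.+ x) ℤ.⊓ (y ℤ.+ y)
  sum-minus-abs-diff x y with ℤP.≤-total x y
  ... | inj₁ x≤y = begin
    (x ℤ.+ y) ℤ.- abs (x ℤ.- y)        ≡⟨ cong (λ v → (x ℤ.+ y) ℤ.- v) (abs-nonPos (ℤP.i≤j⇒i-j≤0 x≤y)) ⟩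
    (x ℤ.+ y) ℤ.- ℤ.- (x ℤ.- y)        ≡⟨ cancel x y ⟩
    x ℤ.+ x                            ≡⟨ ℤP.i≤j⇒i⊓j≡i (ℤP.+-mono-≤ x≤y x≤y) ⟨
    (x ℤ.+ x) ℤ.⊓ (y ℤ.+ y)            ∎
    where
    open ≡-Reasoning
    cancel : ∀ x y → (x ℤ.+ y) ℤ.- ℤ.- (x ℤ.- y) ≡ x ℤ.+ x
    cancel = ℤ-Solver.solve-∀
  ... | inj₂ y≤x = begin
    (x ℤ.+ y) ℤ.- abs (x ℤ.- y)        ≡⟨ cong (λ v → (x ℤ.+ y) ℤ.- v) (ℤP.0≤i⇒+∣i∣≡i (ℤP.i≤j⇒0≤j-i y≤x)) ⟩
    (x ℤ.+ y) ℤ.- (x ℤ.- y)            ≡⟨ cancel x y ⟩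
    y ℤ.+ y                            ≡⟨ ℤP.i≥j⇒i⊓j≡j (ℤP.+-mono-≤ y≤x y≤x) ⟨
    (x ℤ.+ x) ℤ.⊓ (y ℤ.+ y)            ∎
    where
    open ≡-Reasoning
    cancel : ∀ x y → (x ℤ.+ y) ℤ.- (x ℤ.- y) ≡ y ℤ.+ y
    cancel = ℤ-Solver.solve-∀

  -- the order at t = 0 of M_{p/q}(t ^ α, t ^ β, 1)
  tropicalMarkov₀ : ℕ → ℕ → ℕ → ℕ → ℤ
  tropicalMarkov₀ α β = absLinear (+ α ℤ.+ + β) (+ α) (ℤ.- + β)

  module _ (α β : ℕ) where
    private
      f = tropicalMarkov₀ α β

    tropicalMarkov₀-01 : f 0 1 ≡ + α
    tropicalMarkov₀-01 = trans (cong (λ v → (+ α ℤ.+ + β) ℤ.- abs v) (linear-01 (+ α) (ℤ.- + β)))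
                               (trans (cong (λ v → (+ α ℤ.+ + β) ℤ.- v) (abs-neg (+ β))) (cancel (+ α) (+ β)))
      where
      linear-01 : ∀ μ ν → μ ℤ.* + 0 ℤ.+ ν ℤ.* + 1 ≡ ν
      linear-01 = ℤ-Solver.solve-∀
      cancel : ∀ x y → (x ℤ.+ y) ℤ.- y ≡ x
      cancel = ℤ-Solver.solve-∀

    tropicalMarkov₀-10 : f 1 0 ≡ + β
    tropicalMarkov₀-10 = trans (cong (λ v → (+ α ℤ.+ + β) ℤ.- abs v) (linear-10 (+ α) (ℤ.- + β))) (cancel (+ α) (+ β))
      where
      linear-10 : ∀ μ ν → μ ℤ.* + 1 ℤ.+ ν ℤ.* + 0 ≡ μ
      linear-10 = ℤ-Solver.solve-∀
      cancel : ∀ x y → (x ℤ.+ y) ℤ.- x ≡ y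
      cancel = ℤ-Solver.solve-∀

    tropicalMarkov₀-11 : f 1 1 ≡ tropicalStep (+ α) (+ β) (+ 0)
    tropicalMarkov₀-11 = begin
      (+ α ℤ.+ + β) ℤ.- abs (+ α ℤ.* + 1 ℤ.+ ℤ.- + β ℤ.* + 1) ≡⟨ cong (λ v → (+ α ℤ.+ + β) ℤ.- abs v) (linear-11 (+ α) (+ β)) ⟩
      (+ α ℤ.+ + β) ℤ.- abs (+ α ℤ.- + β)                     ≡⟨ sum-minus-abs-diff (+ α) (+ β) ⟩
      (+ α ℤ.+ + α) ℤ.⊓ (+ β ℤ.+ + β)                         ≡⟨ ℤP.+-identityʳ _ ⟨
      tropicalStep (+ α) (+ β) (+ 0)                          ∎
      where
      open ≡-Reasoning
      linear-11 : ∀ μ ν → μ ℤ.* + 1 ℤ.+ ℤ.- ν ℤ.* + 1 ≡ μ ℤ.- ν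
      linear-11 = ℤ-Solver.solve-∀

  module Specialisation (a′ b′ : ℕ) (A : ℕ → ℕ → ℚ) (numerator : IsNumerator (suc a′) (suc b′) A) (α β γ : ℕ) where

    n = a′ ℕ.+ suc b′
    D = α ℕ.* a′ ℕ.+ (β ℕ.* b′ ℕ.+ γ ℕ.* n)

    weight : ℕ → ℕ → ℕ
    weight i j = α ℕ.* 2 ℕ.* i ℕ.+ (β ℕ.* 2 ℕ.* j ℕ.+ γ ℕ.* 2 ℕ.* (n ∸ i ∸ j))

    open Extraction n A weight public

    M : ℚ → ℚ
    M t = markov (suc a′) (suc b′) (t ^ α) (t ^ β) (t ^ γ)

    markov-monomial : ∀ {t} → 0ℚ < t → M t * t ^ D ≡ S t
    markov-monomial {t} 0<t = begin
      M t * t ^ D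
        ≡⟨ cong (M t *_) (power-split α a′ (β ℕ.* b′ ℕ.+ γ ℕ.* n)) ⟩
      M t * ((t ^ α) ^ a′ * t ^ (β ℕ.* b′ ℕ.+ γ ℕ.* n))
        ≡⟨ cong (λ v → M t * ((t ^ α) ^ a′ * v)) (power-split β b′ (γ ℕ.* n)) ⟩
      M t * ((t ^ α) ^ a′ * ((t ^ β) ^ b′ * t ^ (γ ℕ.* n)))
        ≡⟨ cong (λ v → M t * ((t ^ α) ^ a′ * ((t ^ β) ^ b′ * v))) (sym (^-*-assoc t γ n)) ⟩
      M t * ((t ^ α) ^ a′ * ((t ^ β) ^ b′ * (t ^ γ) ^ n))
        ≡⟨ numerator (t ^ α) (t ^ β) (t ^ γ) (^-pos α 0<t) (^-pos β 0<t) (^-pos γ 0<t) ⟩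
      evalHom n A ((t ^ α) ^ 2) ((t ^ β) ^ 2) ((t ^ γ) ^ 2)
        ≡⟨ Σ△-cong n (λ i j _ → cong (A i j *_) (monomial i j)) ⟩
      S t ∎
      where
      open ≡-Reasoning
      power-split : ∀ δ k r → t ^ (δ ℕ.* k ℕ.+ r) ≡ (t ^ δ) ^ k * t ^ r
      power-split δ k r = trans (^-distribˡ-+-* t (δ ℕ.* k) r) (cong (_* t ^ r) (sym (^-*-assoc t δ k)))
      squared : ∀ δ k → ((t ^ δ) ^ 2) ^ k ≡ t ^ (δ ℕ.* 2 ℕ.* k)
      squared δ k = trans (cong (_^ k) (^-*-assoc t δ 2)) (^-*-assoc t (δ ℕ.* 2) k)
      monomial : ∀ i j → ((t ^ α) ^ 2) ^ i * (((t ^ β) ^ 2) ^ j * ((t ^ γ) ^ 2) ^ (n ∸ i ∸ j)) ≡ t ^ weight i j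
      monomial i j = begin
        ((t ^ α) ^ 2) ^ i * (((t ^ β) ^ 2) ^ j * ((t ^ γ) ^ 2) ^ (n ∸ i ∸ j))
          ≡⟨ cong₂ _*_ (squared α i) (cong₂ _*_ (squared β j) (squared γ (n ∸ i ∸ j))) ⟩
        t ^ (α ℕ.* 2 ℕ.* i) * (t ^ (β ℕ.* 2 ℕ.* j) * t ^ (γ ℕ.* 2 ℕ.* (n ∸ i ∸ j)))
          ≡⟨ cong (t ^ (α ℕ.* 2 ℕ.* i) *_) (^-distribˡ-+-* t (β ℕ.* 2 ℕ.* j) _) ⟨
        t ^ (α ℕ.* 2 ℕ.* i) * t ^ (β ℕ.* 2 ℕ.* j ℕ.+ γ ℕ.* 2 ℕ.* (n ∸ i ∸ j))
          ≡⟨ ^-distribˡ-+-* t (α ℕ.* 2 ℕ.* i) _ ⟨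
        t ^ weight i j ∎

    S-exact : ∀ {e E} → HasOrder M e → e ℤ.+ + D ≡ + E → IsΘ S E 0
    S-exact order e+D≡E =
      IsΘ-cong markov-monomial (HasOrder-exact (subst (HasOrder _) e+D≡E (HasOrder-* order (HasOrder-pow D))))


  digits-injective : ∀ {N} i i′ x x′ → i ℕ.< N → i′ ℕ.< N → i ℕ.+ x ℕ.* N ≡ i′ ℕ.+ x′ ℕ.* N → i ≡ i′ × x ≡ x′
  digits-injective {N} i i′ x x′ i<N i′<N eq = i≡i′ , x≡x′
    where
    instance _ = ℕ.>-nonZero (ℕP.≤-<-trans z≤n i<N)
    i≡i′ : i ≡ i′
    i≡i′ = begin
      i                        ≡⟨ m<n⇒m%n≡m i<N ⟨
      i % N                    ≡⟨ [m+kn]%n≡m%n i x N ⟨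
      (i ℕ.+ x ℕ.* N) % N      ≡⟨ cong (_% N) eq ⟩
      (i′ ℕ.+ x′ ℕ.* N) % N    ≡⟨ [m+kn]%n≡m%n i′ x′ N ⟩
      i′ % N                   ≡⟨ m<n⇒m%n≡m i′<N ⟩
      i′                       ∎
      where open ≡-Reasoning
    x≡x′ : x ≡ x′
    x≡x′ = ℕP.*-cancelʳ-≡ x x′ N (ℕP.+-cancelˡ-≡ i _ _ (trans eq (cong (ℕ._+ x′ ℕ.* N) (sym i≡i′))))

  digits-< : ∀ {N i x y} → i ℕ.< N → x ℕ.< y → i ℕ.+ x ℕ.* N ℕ.< y ℕ.* N
  digits-< {N} {i} {x} i<N x<y = ℕP.<-≤-trans (ℕP.+-monoˡ-< (x ℕ.* N) i<N) (ℕP.*-monoˡ-≤ N x<y)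

  module Vertices (a′ b′ : ℕ) (coprime : Coprime (suc a′) (suc b′))
                  (A : ℕ → ℕ → ℚ) (numerator : IsNumerator (suc a′) (suc b′) A) where

    a = suc a′
    b = suc b′
    n = a′ ℕ.+ suc b′
    N = suc n

    private
      markov-order₀ : ∀ α β → HasOrder (λ t → markov a b (t ^ α) (t ^ β) (t ^ 0)) (tropicalMarkov₀ α β a b)
      markov-order₀ α β =
        markov-order coprime {tropicalMarkov₀ α β} (absLinear-tropical (+ α ℤ.+ + β) (+ α) (ℤ.- + β)) (s≤s z≤n) (s≤s z≤n) α β 0
        (tropicalMarkov₀-01 α β) (tropicalMarkov₀-10 α β) (tropicalMarkov₀-11 α β)

      in△ : ∀ {i j} → i ℕ.+ j ℕ.≤ n → i ℕ.< N
      in△ {i} {j} i+j≤n = s≤s (ℕP.≤-trans (ℕP.m≤m+n i j) i+j≤n)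

      double-pos : ∀ {k} → 0 ℕ.< k → 0 ℕ.< 1 ℕ.* 2 ℕ.* k
      double-pos {k} 0<k = ℕP.<-≤-trans 0<k (ℕP.m≤m+n k (1 ℕ.* k))

    -- The weight 2 (i + (b i + a j) N) orders monomials by b i + a j and then by i < N, so it is
    -- injective and (0 , b) is the lightest point on the line b i + a j = a b.
    module Corner-0b where
      α = b ℕ.* N ℕ.+ 1
      β = a ℕ.* N
      open Specialisation a′ b′ A numerator α β 0 hiding (n)

      E = (a ℕ.* b) ℕ.* N ℕ.* 2

      order : tropicalMarkov₀ α β a b ℤ.+ + D ≡ + E
      order = begin
        (+ α ℤ.+ + β) ℤ.- abs (linear (+ α) (ℤ.- + β) a b) ℤ.+ + D
          ≡⟨ cong (λ v → (+ α ℤ.+ + β) ℤ.- abs v ℤ.+ + D) linear-ab ⟩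
        (+ α ℤ.+ + β) ℤ.- + a ℤ.+ + D
          ≡⟨ cong (λ v → v ℤ.- + a ℤ.+ + D) (ℤP.pos-+ α β) ⟨
        + (α ℕ.+ β) ℤ.- + a ℤ.+ + D
          ≡⟨ pos-diff-+-pos {α ℕ.+ β} {a} {D} {E} (e₂ a′ b′ N) ⟩
        + E ∎
        where
        open ≡-Reasoning
        e₁ : ∀ a′ b′ N → (suc b′ ℕ.* N ℕ.+ 1) ℕ.* suc a′ ℕ.+ 0 ≡ suc a′ ℕ.+ suc a′ ℕ.* N ℕ.* suc b′
        e₁ = ℕ-Solver.solve-∀
        e₂ : ∀ a′ b′ N → (suc b′ ℕ.* N ℕ.+ 1 ℕ.+ suc a′ ℕ.* N)
                           ℕ.+ ((suc b′ ℕ.* N ℕ.+ 1) ℕ.* a′ ℕ.+ (suc a′ ℕ.* N ℕ.* b′ ℕ.+ 0 ℕ.* (a′ ℕ.+ suc b′)))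
                         ≡ suc a′ ℕ.* suc b′ ℕ.* N ℕ.* 2 ℕ.+ suc a′
        e₂ = ℕ-Solver.solve-∀
        linear-ab : linear (+ α) (ℤ.- + β) a b ≡ + a
        linear-ab = trans (linear-pos-neg α β a b) (trans (sym (ℤP.+-identityʳ _)) (pos-diff-+-pos {α ℕ.* a} {β ℕ.* b} {0} {a} (e₁ a′ b′ N)))

      exact : IsΘ S E 0
      exact = S-exact (markov-order₀ α β) order

      weight-digits : ∀ i j → weight i j ≡ (i ℕ.+ (b ℕ.* i ℕ.+ a ℕ.* j) ℕ.* N) ℕ.* 2
      weight-digits i j = e a′ b′ N i j (n ∸ i ∸ j)
        where e : ∀ a′ b′ N i j r → (suc b′ ℕ.* N ℕ.+ 1) ℕ.* 2 ℕ.* i ℕ.+ (suc a′ ℕ.* N ℕ.* 2 ℕ.* j ℕ.+ 0 ℕ.* 2 ℕ.* r)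
                                     ≡ (i ℕ.+ (suc b′ ℕ.* i ℕ.+ suc a′ ℕ.* j) ℕ.* N) ℕ.* 2
              e = ℕ-Solver.solve-∀

      line : ℕ → ℕ → ℕ
      line i j = b ℕ.* i ℕ.+ a ℕ.* j

      injective : InjectiveOn△
      injective {i} {j} {i′} {j′} i+j≤n i′+j′≤n w≡w′
        with digits-injective i i′ (line i j) (line i′ j′) (in△ {i} {j} i+j≤n) (in△ {i′} {j′} i′+j′≤n)
               (ℕP.*-cancelʳ-≡ (i ℕ.+ line i j ℕ.* N) (i′ ℕ.+ line i′ j′ ℕ.* N) 2
                 (trans (sym (weight-digits i j)) (trans w≡w′ (weight-digits i′ j′))))
      ... | refl , same-line = cong (i ,_) (ℕP.*-cancelˡ-≡ j j′ a (ℕP.+-cancelˡ-≡ (b ℕ.* i) _ _ same-line))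

      open ByWeight injective {E} {hi exact} (ℚP.<⇒≤ (hi-pos exact)) (IsΘ₀-upper exact)

      below-line : ∀ i j → i ℕ.+ j ℕ.≤ n → line i j ℕ.< a ℕ.* b → A i j ≡ 0ℚ
      below-line i j i+j≤n below = lighter-vanish E ℕP.≤-refl i j i+j≤n
        (subst (ℕ._< E) (sym (weight-digits i j)) (ℕP.*-monoˡ-< 2 (digits-< (in△ {i} {j} i+j≤n) below)))

      corner-in△ : 0 ℕ.+ b ℕ.≤ n
      corner-in△ = ℕP.m≤n+m b a′

      corner : A 0 b ≢ 0ℚ
      corner = isolated-nonzero corner-in△ weight≡E
        (isolated-by-weight corner-in△ weight≡E (lighter-vanish E ℕP.≤-refl)) (lo-pos exact) (IsΘ₀-lower exact)
        where
        weight≡E : weight 0 b ≡ E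
        weight≡E = trans (weight-digits 0 b) (e a′ b′ N)
          where e : ∀ a′ b′ N → (0 ℕ.+ (suc b′ ℕ.* 0 ℕ.+ suc a′ ℕ.* suc b′) ℕ.* N) ℕ.* 2 ≡ suc a′ ℕ.* suc b′ ℕ.* N ℕ.* 2
                e = ℕ-Solver.solve-∀

    module Corner-a0 where
      α = b ℕ.* N
      β = a ℕ.* N ℕ.+ 1
      open Specialisation a′ b′ A numerator α β 0 hiding (n)

      E = (a ℕ.* b) ℕ.* N ℕ.* 2

      order : tropicalMarkov₀ α β a b ℤ.+ + D ≡ + E
      order = begin
        (+ α ℤ.+ + β) ℤ.- abs (linear (+ α) (ℤ.- + β) a b) ℤ.+ + D
          ≡⟨ cong (λ v → (+ α ℤ.+ + β) ℤ.- abs v ℤ.+ + D) linear-ab ⟩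
        (+ α ℤ.+ + β) ℤ.- abs (ℤ.- + b) ℤ.+ + D
          ≡⟨ cong₂ (λ u v → u ℤ.- v ℤ.+ + D) (ℤP.pos-+ α β) (abs-neg (+ b)) ⟨
        + (α ℕ.+ β) ℤ.- + b ℤ.+ + D
          ≡⟨ pos-diff-+-pos {α ℕ.+ β} {b} {D} {E} (e₂ a′ b′ N) ⟩
        + E ∎
        where
        open ≡-Reasoning
        e₁ : ∀ a′ b′ N → suc b′ ℕ.* N ℕ.* suc a′ ℕ.+ suc b′ ≡ 0 ℕ.+ (suc a′ ℕ.* N ℕ.+ 1) ℕ.* suc b′
        e₁ = ℕ-Solver.solve-∀
        e₂ : ∀ a′ b′ N → (suc b′ ℕ.* N ℕ.+ (suc a′ ℕ.* N ℕ.+ 1))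
                           ℕ.+ (suc b′ ℕ.* N ℕ.* a′ ℕ.+ ((suc a′ ℕ.* N ℕ.+ 1) ℕ.* b′ ℕ.+ 0 ℕ.* (a′ ℕ.+ suc b′)))
                         ≡ suc a′ ℕ.* suc b′ ℕ.* N ℕ.* 2 ℕ.+ suc b′
        e₂ = ℕ-Solver.solve-∀
        linear-ab : linear (+ α) (ℤ.- + β) a b ≡ ℤ.- + b
        linear-ab = trans (linear-pos-neg α β a b)
          (trans (diff-≡ {+ (α ℕ.* a)} {+ (β ℕ.* b)} {+ 0} {+ b}
                    (trans (sym (ℤP.pos-+ (α ℕ.* a) b)) (trans (cong +_ (e₁ a′ b′ N)) (ℤP.pos-+ 0 (β ℕ.* b)))))
                 (ℤP.+-identityˡ (ℤ.- + b)))

      exact : IsΘ S E 0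
      exact = S-exact (markov-order₀ α β) order

      weight-digits : ∀ i j → weight i j ≡ (j ℕ.+ (b ℕ.* i ℕ.+ a ℕ.* j) ℕ.* N) ℕ.* 2
      weight-digits i j = e a′ b′ N i j (n ∸ i ∸ j)
        where e : ∀ a′ b′ N i j r → suc b′ ℕ.* N ℕ.* 2 ℕ.* i ℕ.+ ((suc a′ ℕ.* N ℕ.+ 1) ℕ.* 2 ℕ.* j ℕ.+ 0 ℕ.* 2 ℕ.* r)
                                     ≡ (j ℕ.+ (suc b′ ℕ.* i ℕ.+ suc a′ ℕ.* j) ℕ.* N) ℕ.* 2
              e = ℕ-Solver.solve-∀

      line : ℕ → ℕ → ℕ
      line i j = b ℕ.* i ℕ.+ a ℕ.* j

      injective : InjectiveOn△
      injective {i} {j} {i′} {j′} i+j≤n i′+j′≤n w≡w′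
        with digits-injective j j′ (line i j) (line i′ j′)
               (in△ {j} {i} (subst (ℕ._≤ n) (ℕP.+-comm i j) i+j≤n)) (in△ {j′} {i′} (subst (ℕ._≤ n) (ℕP.+-comm i′ j′) i′+j′≤n))
               (ℕP.*-cancelʳ-≡ (j ℕ.+ line i j ℕ.* N) (j′ ℕ.+ line i′ j′ ℕ.* N) 2
                 (trans (sym (weight-digits i j)) (trans w≡w′ (weight-digits i′ j′))))
      ... | refl , same-line = cong (_, j) (ℕP.*-cancelˡ-≡ i i′ b (ℕP.+-cancelʳ-≡ (a ℕ.* j) (b ℕ.* i) (b ℕ.* i′) same-line))

      open ByWeight injective {E} {hi exact} (ℚP.<⇒≤ (hi-pos exact)) (IsΘ₀-upper exact)

      corner-in△ : a ℕ.+ 0 ℕ.≤ n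
      corner-in△ = subst (ℕ._≤ n) (sym (ℕP.+-identityʳ a)) (subst (a ℕ.≤_) (sym (ℕP.+-suc a′ b′)) (s≤s (ℕP.m≤m+n a′ b′)))

      corner : A a 0 ≢ 0ℚ
      corner = isolated-nonzero corner-in△ weight≡E
        (isolated-by-weight corner-in△ weight≡E (lighter-vanish E ℕP.≤-refl)) (lo-pos exact) (IsΘ₀-lower exact)
        where
        weight≡E : weight a 0 ≡ E
        weight≡E = trans (weight-digits a 0) (e a′ b′ N)
          where e : ∀ a′ b′ N → (0 ℕ.+ (suc b′ ℕ.* suc a′ ℕ.+ suc a′ ℕ.* 0) ℕ.* N) ℕ.* 2 ≡ suc a′ ℕ.* suc b′ ℕ.* N ℕ.* 2
                e = ℕ-Solver.solve-∀

    module Corner-n0 where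
      open Specialisation a′ b′ A numerator 0 1 1 hiding (n)

      order : absLinear (+ 2) (+ 1) (+ 2) a b ℤ.+ + D ≡ + 0
      order = trans (cong (λ v → + 2 ℤ.- abs v ℤ.+ + D) (linear-pos 1 2 a b))
                    (pos-diff-+-pos {2} {1 ℕ.* a ℕ.+ 2 ℕ.* b} {D} {0} (e a′ b′))
        where e : ∀ a′ b′ → 2 ℕ.+ (0 ℕ.* a′ ℕ.+ (1 ℕ.* b′ ℕ.+ 1 ℕ.* (a′ ℕ.+ suc b′))) ≡ 0 ℕ.+ (1 ℕ.* suc a′ ℕ.+ 2 ℕ.* suc b′)
              e = ℕ-Solver.solve-∀

      exact : IsΘ S 0 0
      exact = S-exact (markov-order coprime {absLinear (+ 2) (+ 1) (+ 2)} (absLinear-tropical (+ 2) (+ 1) (+ 2))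
                                    (s≤s z≤n) (s≤s z≤n) 0 1 1 refl refl refl) order

      isolated : Isolated n 0 0
      isolated i (suc j) _ _ = inj₂ (s≤s z≤n)
      isolated i zero i+0≤n ij≢ = inj₂ (double-pos (ℕP.m<n⇒0<n∸m (ℕP.≤∧≢⇒< (subst (ℕ._≤ n) (ℕP.+-identityʳ i) i+0≤n)
                                                                          (λ i≡n → ij≢ (cong (_, 0) i≡n)))))

      corner : A n 0 ≢ 0ℚ
      corner = isolated-nonzero (ℕP.≤-reflexive (ℕP.+-identityʳ n)) (cong (1 ℕ.* 2 ℕ.*_) (ℕP.n∸n≡0 n)) isolated
                                (lo-pos exact) (IsΘ₀-lower exact)

    module Corner-0n where
      open Specialisation a′ b′ A numerator 1 0 1 hiding (n)

      order : absLinear (+ 2) (+ 2) (+ 1) a b ℤ.+ + D ≡ + 0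
      order = trans (cong (λ v → + 2 ℤ.- abs v ℤ.+ + D) (linear-pos 2 1 a b))
                    (pos-diff-+-pos {2} {2 ℕ.* a ℕ.+ 1 ℕ.* b} {D} {0} (e a′ b′))
        where e : ∀ a′ b′ → 2 ℕ.+ (1 ℕ.* a′ ℕ.+ (0 ℕ.* b′ ℕ.+ 1 ℕ.* (a′ ℕ.+ suc b′))) ≡ 0 ℕ.+ (2 ℕ.* suc a′ ℕ.+ 1 ℕ.* suc b′)
              e = ℕ-Solver.solve-∀

      exact : IsΘ S 0 0
      exact = S-exact (markov-order coprime {absLinear (+ 2) (+ 2) (+ 1)} (absLinear-tropical (+ 2) (+ 2) (+ 1))
                                    (s≤s z≤n) (s≤s z≤n) 1 0 1 refl refl refl) order

      isolated : Isolated 0 n 0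
      isolated (suc i) j _ _ = inj₂ (s≤s z≤n)
      isolated zero j j≤n ij≢ = inj₂ (double-pos (ℕP.m<n⇒0<n∸m (ℕP.≤∧≢⇒< j≤n (λ j≡n → ij≢ (cong (0 ,_) j≡n)))))

      corner : A 0 n ≢ 0ℚ
      corner = isolated-nonzero ℕP.≤-refl (cong (1 ℕ.* 2 ℕ.*_) (ℕP.n∸n≡0 n)) isolated (lo-pos exact) (IsΘ₀-lower exact)

  -- Convex hulls

  private
    ι≡mkℚ : ∀ m → ι m ≡ mkℚ (+ m) 0 (Coprimality.sym (1-coprimeTo m))
    ι≡mkℚ m = ℚP.↥p/↧p≡p (mkℚ (+ m) 0 (Coprimality.sym (1-coprimeTo m)))

  ι-+ : ∀ m n → ι (m ℕ.+ n) ≡ ι m + ι n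
  ι-+ m n = sym (trans (cong₂ _+_ (ι≡mkℚ m) (ι≡mkℚ n)) (cong (ℚ._/ 1) numerator))
    where numerator : + m ℤ.* + 1 ℤ.+ + n ℤ.* + 1 ≡ + (m ℕ.+ n)
          numerator = trans (cong₂ ℤ._+_ (ℤP.*-identityʳ (+ m)) (ℤP.*-identityʳ (+ n))) (sym (ℤP.pos-+ m n))

  ι-* : ∀ m n → ι (m ℕ.* n) ≡ ι m * ι n
  ι-* m n = sym (trans (cong₂ _*_ (ι≡mkℚ m) (ι≡mkℚ n)) (cong (ℚ._/ 1) (sym (ℤP.pos-* m n))))

  ι-nonNeg : ∀ m → 0ℚ ≤ ι m
  ι-nonNeg m = ℚP.nonNegative⁻¹ (ι m) {{ℚP.normalize-nonNeg m 1}}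

  ι-mono : ∀ {m n} → m ℕ.≤ n → ι m ≤ ι n
  ι-mono {m} {n} m≤n = subst (ι m ≤_) (trans (sym (ι-+ m (n ∸ m))) (cong ι (ℕP.m+[n∸m]≡n m≤n)))
    (subst (_≤ ι m + ι (n ∸ m)) (ℚP.+-identityʳ (ι m)) (ℚP.+-monoʳ-≤ (ι m) (ι-nonNeg (n ∸ m))))

  ι-pos : ∀ k → 0ℚ < ι (suc k)
  ι-pos k = ℚP.<-≤-trans 0<1 (ι-mono {1} {suc k} (s≤s z≤n))

  InConv-triangle : ∀ {S : ℕ → ℕ → Set} {i₁ j₁ i₂ j₂ i₃ j₃ s t} (N₁ N₂ N₃ D : ℚ) →
    S i₁ j₁ → S i₂ j₂ → S i₃ j₃ → 0ℚ < D → 0ℚ ≤ N₁ → 0ℚ ≤ N₂ → 0ℚ ≤ N₃ →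
    N₁ + N₂ + N₃ ≡ D →
    N₁ * ι i₁ + N₂ * ι i₂ + N₃ * ι i₃ ≡ D * s →
    N₁ * ι j₁ + N₂ * ι j₂ + N₃ * ι j₃ ≡ D * t →
    InConv S s t
  InConv-triangle {i₁ = i₁} {j₁} {i₂} {j₂} {i₃} {j₃} {s} {t} N₁ N₂ N₃ D P₁ P₂ P₃ 0<D 0≤N₁ 0≤N₂ 0≤N₃ sum≡D Σi≡Ds Σj≡Dt =
    (i₁ , j₁ , N₁ * d) ∷ (i₂ , j₂ , N₂ * d) ∷ (i₃ , j₃ , N₃ * d) ∷ [] ,
    (P₁ , *-nonNeg 0≤N₁ 0≤d) ∷ (P₂ , *-nonNeg 0≤N₂ 0≤d) ∷ (P₃ , *-nonNeg 0≤N₃ 0≤d) ∷ [] ,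
    trans (scale-1 N₁ N₂ N₃ d) (trans (cong (d *_) sum≡D) d*D≡1) ,
    trans (scale N₁ N₂ N₃ d (ι i₁) (ι i₂) (ι i₃)) (trans (cong (d *_) Σi≡Ds) (cancel s)) ,
    trans (scale N₁ N₂ N₃ d (ι j₁) (ι j₂) (ι j₃)) (trans (cong (d *_) Σj≡Dt) (cancel t))
    where
    d = 1ℚ ⊘ D
    0≤d = ℚP.<⇒≤ (⊘-pos 0<1 0<D)
    d*D≡1 : d * D ≡ 1ℚ
    d*D≡1 = ⊘-cancelʳ 1ℚ 0<D
    cancel : ∀ x → d * (D * x) ≡ x
    cancel x = trans (sym (ℚP.*-assoc d D x)) (trans (cong (_* x) d*D≡1) (ℚP.*-identityˡ x))
    scale-1 : ∀ N₁ N₂ N₃ d → N₁ * d + (N₂ * d + (N₃ * d + 0ℚ)) ≡ d * (N₁ + N₂ + N₃)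
    scale-1 = solve 4 (λ N₁ N₂ N₃ d → N₁ :* d :+ (N₂ :* d :+ (N₃ :* d :+ con 0ℚ)) := d :* (N₁ :+ N₂ :+ N₃)) refl
    scale : ∀ N₁ N₂ N₃ d x₁ x₂ x₃ → N₁ * d * x₁ + (N₂ * d * x₂ + (N₃ * d * x₃ + 0ℚ)) ≡ d * (N₁ * x₁ + N₂ * x₂ + N₃ * x₃)
    scale = solve 7 (λ N₁ N₂ N₃ d x₁ x₂ x₃ →
      N₁ :* d :* x₁ :+ (N₂ :* d :* x₂ :+ (N₃ :* d :* x₃ :+ con 0ℚ)) := d :* (N₁ :* x₁ :+ N₂ :* x₂ :+ N₃ :* x₃)) refl

  InConv-lower : ∀ {S : ℕ → ℕ → Set} {c u v s t} → (∀ i j → S i j → c ≤ u * ι i + v * ι j) →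
    InConv S s t → c ≤ u * s + v * t
  InConv-lower {S} {c} {u} {v} {s} {t} bound (ps , good , wsum≡1 , wsumI≡s , wsumJ≡t) =
    subst₂ _≤_ (trans (cong (c *_) wsum≡1) (ℚP.*-identityʳ c)) (cong₂ (λ x y → u * x + v * y) wsumI≡s wsumJ≡t)
      (weighted ps good)
    where
    weighted : ∀ ps → All (GoodPt S) ps → c * wsum ps ≤ u * wsumI ps + v * wsumJ ps
    weighted [] [] = ℚP.≤-reflexive (zeros c u v)
      where zeros : ∀ c u v → c * 0ℚ ≡ u * 0ℚ + v * 0ℚ
            zeros = solve 3 (λ c u v → c :* con 0ℚ := u :* con 0ℚ :+ v :* con 0ℚ) refl
    weighted ((i , j , l) ∷ ps) ((Sij , 0≤l) ∷ good) =
      subst₂ _≤_ (split-c c l (wsum ps)) (split-uv u v l (ι i) (ι j) (wsumI ps) (wsumJ ps))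
        (ℚP.+-mono-≤ (*-monoˡ-≤ 0≤l (bound i j Sij)) (weighted ps good))
      where
      split-c : ∀ c l W → l * c + c * W ≡ c * (l + W)
      split-c = solve 3 (λ c l W → l :* c :+ c :* W := c :* (l :+ W)) refl
      split-uv : ∀ u v l x y X Y → l * (u * x + v * y) + (u * X + v * Y) ≡ u * (l * x + X) + v * (l * y + Y)
      split-uv = solve 7 (λ u v l x y X Y →
        l :* (u :* x :+ v :* y) :+ (u :* X :+ v :* Y) := u :* (l :* x :+ X) :+ v :* (l :* y :+ Y)) refl

  InConv-upper : ∀ {S : ℕ → ℕ → Set} {c u v s t} → (∀ i j → S i j → u * ι i + v * ι j ≤ c) →
    InConv S s t → u * s + v * t ≤ c
  InConv-upper {c = c} {u} {v} {s} {t} bound hull =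
    subst₂ _≤_ (unnegate u v s t) (neg-neg c)
      (ℚP.neg-antimono-≤ (InConv-lower {c = - c} {u = - u} {v = - v} (λ i j Sij →
        subst (- c ≤_) (negate u v (ι i) (ι j)) (ℚP.neg-antimono-≤ (bound i j Sij))) hull))
    where
    negate : ∀ u v x y → - (u * x + v * y) ≡ - u * x + - v * y
    negate = solve 4 (λ u v x y → :- (u :* x :+ v :* y) := (:- u) :* x :+ (:- v) :* y) refl
    unnegate : ∀ u v x y → - ((- u) * x + (- v) * y) ≡ u * x + v * y
    unnegate = solve 4 (λ u v x y → :- ((:- u) :* x :+ (:- v) :* y) := u :* x :+ v :* y) refl
    neg-neg : ∀ c → - - c ≡ c
    neg-neg = solve 1 (λ c → :- (:- c) := c) refl

  InConv⇒InRegion : ∀ {S : ℕ → ℕ → Set} {a b s t} →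
    (∀ i j → S i j → i ℕ.+ j ℕ.≤ (a ℕ.+ b) ∸ 1) → (∀ i j → S i j → a ℕ.* b ℕ.≤ b ℕ.* i ℕ.+ a ℕ.* j) →
    InConv S s t → InRegion a b s t
  InConv⇒InRegion {a = a} {b} {s} {t} in△ above-line hull =
    subst (0ℚ ≤_) (first s t) (InConv-lower {c = 0ℚ} {u = 1ℚ} {v = 0ℚ} (λ i j _ → subst (0ℚ ≤_) (sym (first (ι i) (ι j))) (ι-nonNeg i)) hull) ,
    subst (0ℚ ≤_) (second s t) (InConv-lower {c = 0ℚ} {u = 0ℚ} {v = 1ℚ} (λ i j _ → subst (0ℚ ≤_) (sym (second (ι i) (ι j))) (ι-nonNeg j)) hull) ,
    InConv-lower {c = ι (a ℕ.* b)} {u = ι b} {v = ι a} (λ i j Sij → subst (ι (a ℕ.* b) ≤_) (ι-line i j) (ι-mono (above-line i j Sij))) hull ,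
    subst (_≤ ι ((a ℕ.+ b) ∸ 1)) (both s t)
      (InConv-upper {c = ι ((a ℕ.+ b) ∸ 1)} {u = 1ℚ} {v = 1ℚ}
        (λ i j Sij → subst (_≤ ι ((a ℕ.+ b) ∸ 1)) (trans (ι-+ i j) (sym (both (ι i) (ι j)))) (ι-mono (in△ i j Sij))) hull)
    where
    first : ∀ x y → 1ℚ * x + 0ℚ * y ≡ x
    first = solve 2 (λ x y → con 1ℚ :* x :+ con 0ℚ :* y := x) refl
    second : ∀ x y → 0ℚ * x + 1ℚ * y ≡ y
    second = solve 2 (λ x y → con 0ℚ :* x :+ con 1ℚ :* y := y) refl
    both : ∀ x y → 1ℚ * x + 1ℚ * y ≡ x + y
    both = solve 2 (λ x y → con 1ℚ :* x :+ con 1ℚ :* y := x :+ y) refl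
    ι-line : ∀ i j → ι (b ℕ.* i ℕ.+ a ℕ.* j) ≡ ι b * ι i + ι a * ι j
    ι-line i j = trans (ι-+ (b ℕ.* i) (a ℕ.* j)) (cong₂ _+_ (ι-* b i) (ι-* a j))

  InConv-a0-n0-0n : ∀ {S : ℕ → ℕ → Set} {a n s t} Y → ι n ≡ ι a + Y → 0ℚ < ι a → 0ℚ < Y →
    S a 0 → S n 0 → S 0 n → 0ℚ ≤ t → s + t ≤ ι n → ι a * ι n ≤ ι n * s + ι a * t → InConv S s t
  InConv-a0-n0-0n {a = a} {n} {s} {t} Y n≡a+Y 0<A 0<Y Pa0 Pn0 P0n 0≤t s+t≤n an≤ns+at =
    InConv-triangle (L * (L - (s + t))) ((L * s + A * t) - A * L) (t * Y) (L * Y) Pa0 Pn0 P0n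
      (*-pos 0<L 0<Y)
      (*-nonNeg (ℚP.<⇒≤ 0<L) (p≤q⇒0≤q-p (subst (s + t ≤_) n≡a+Y s+t≤n)))
      (p≤q⇒0≤q-p (subst (λ L → A * L ≤ L * s + A * t) n≡a+Y an≤ns+at))
      (*-nonNeg 0≤t (ℚP.<⇒≤ 0<Y))
      (weights A Y s t)
      (trans (cong (λ v → L * (L - (s + t)) * A + ((L * s + A * t) - A * L) * v + t * Y * 0ℚ) n≡a+Y) (first A Y s t))
      (trans (cong (λ v → L * (L - (s + t)) * 0ℚ + ((L * s + A * t) - A * L) * 0ℚ + t * Y * v) n≡a+Y) (second A Y s t))
    where
    A = ι a
    L = A + Y
    0<L : 0ℚ < L
    0<L = +-pos 0<A (ℚP.<⇒≤ 0<Y)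
    weights : ∀ A Y s t → let L = A + Y in L * (L - (s + t)) + ((L * s + A * t) - A * L) + t * Y ≡ L * Y
    weights = solve 4 (λ A Y s t → (A :+ Y) :* ((A :+ Y) :- (s :+ t)) :+ (((A :+ Y) :* s :+ A :* t) :- A :* (A :+ Y)) :+ t :* Y
                                   := (A :+ Y) :* Y) refl
    first : ∀ A Y s t → let L = A + Y in L * (L - (s + t)) * A + ((L * s + A * t) - A * L) * L + t * Y * 0ℚ ≡ L * Y * s
    first = solve 4 (λ A Y s t → (A :+ Y) :* ((A :+ Y) :- (s :+ t)) :* A :+ (((A :+ Y) :* s :+ A :* t) :- A :* (A :+ Y)) :* (A :+ Y)
                                 :+ t :* Y :* con 0ℚ := (A :+ Y) :* Y :* s) refl
    second : ∀ A Y s t → let L = A + Y in L * (L - (s + t)) * 0ℚ + ((L * s + A * t) - A * L) * 0ℚ + t * Y * L ≡ L * Y * t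
    second = solve 4 (λ A Y s t → (A :+ Y) :* ((A :+ Y) :- (s :+ t)) :* con 0ℚ :+ (((A :+ Y) :* s :+ A :* t) :- A :* (A :+ Y)) :* con 0ℚ
                                  :+ t :* Y :* (A :+ Y) := (A :+ Y) :* Y :* t) refl

  InConv-a0-0n-0b : ∀ {S : ℕ → ℕ → Set} {a b n s t} X → ι n ≡ X + ι b → 0ℚ < ι a → 0ℚ < X →
    S a 0 → S 0 n → S 0 b → 0ℚ ≤ s → ι a * ι b ≤ ι b * s + ι a * t → ι n * s + ι a * t ≤ ι a * ι n → InConv S s t
  InConv-a0-0n-0b {a = a} {b} {n} {s} {t} X n≡X+b 0<A 0<X Pa0 P0n P0b 0≤s ab≤bs+at ns+at≤an =
    InConv-triangle (s * X) ((B * s + A * t) - A * B) (A * L - (L * s + A * t)) (A * X) Pa0 P0n P0b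
      (*-pos 0<A 0<X)
      (*-nonNeg 0≤s (ℚP.<⇒≤ 0<X))
      (p≤q⇒0≤q-p ab≤bs+at)
      (p≤q⇒0≤q-p (subst (λ L → L * s + A * t ≤ A * L) n≡X+b ns+at≤an))
      (weights A B X s t)
      (first A B X s t)
      (trans (cong (λ v → s * X * 0ℚ + ((B * s + A * t) - A * B) * v + (A * L - (L * s + A * t)) * B) n≡X+b) (second A B X s t))
    where
    A = ι a
    B = ι b
    L = X + B
    weights : ∀ A B X s t → let L = X + B in s * X + ((B * s + A * t) - A * B) + (A * L - (L * s + A * t)) ≡ A * X
    weights = solve 5 (λ A B X s t → s :* X :+ ((B :* s :+ A :* t) :- A :* B) :+ (A :* (X :+ B) :- ((X :+ B) :* s :+ A :* t))
                                     := A :* X) refl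
    first : ∀ A B X s t → let L = X + B in s * X * A + ((B * s + A * t) - A * B) * 0ℚ + (A * L - (L * s + A * t)) * 0ℚ ≡ A * X * s
    first = solve 5 (λ A B X s t → s :* X :* A :+ ((B :* s :+ A :* t) :- A :* B) :* con 0ℚ
                                   :+ (A :* (X :+ B) :- ((X :+ B) :* s :+ A :* t)) :* con 0ℚ := A :* X :* s) refl
    second : ∀ A B X s t → let L = X + B in s * X * 0ℚ + ((B * s + A * t) - A * B) * L + (A * L - (L * s + A * t)) * B ≡ A * X * t
    second = solve 5 (λ A B X s t → s :* X :* con 0ℚ :+ ((B :* s :+ A :* t) :- A :* B) :* (X :+ B)
                                    :+ (A :* (X :+ B) :- ((X :+ B) :* s :+ A :* t)) :* B := A :* X :* t) refl

  InRegion⇒InConv : ∀ {S : ℕ → ℕ → Set} a′ b′ {s t} → suc a′ ℕ.≤ suc b′ →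
    S (suc a′) 0 → S (a′ ℕ.+ suc b′) 0 → S 0 (a′ ℕ.+ suc b′) → S 0 (suc b′) →
    InRegion (suc a′) (suc b′) s t → InConv S s t
  InRegion⇒InConv zero zero {s} {t} _ P10 _ P01 _ (0≤s , 0≤t , 1≤s+t , s+t≤1) =
    InConv-triangle s t 0ℚ 1ℚ P10 P01 P10 0<1 0≤s 0≤t ℚP.≤-refl
      (trans (ℚP.+-identityʳ (s + t)) (ℚP.≤-antisym s+t≤1 (subst (1ℚ ≤_) (both s t) 1≤s+t)))
      (first s t) (second s t)
    where
    both : ∀ s t → 1ℚ * s + 1ℚ * t ≡ s + t
    both = solve 2 (λ s t → con 1ℚ :* s :+ con 1ℚ :* t := s :+ t) refl
    first : ∀ s t → s * 1ℚ + t * 0ℚ + 0ℚ * 1ℚ ≡ 1ℚ * s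
    first = solve 2 (λ s t → s :* con 1ℚ :+ t :* con 0ℚ :+ con 0ℚ :* con 1ℚ := con 1ℚ :* s) refl
    second : ∀ s t → s * 0ℚ + t * 1ℚ + 0ℚ * 0ℚ ≡ 1ℚ * t
    second = solve 2 (λ s t → s :* con 0ℚ :+ t :* con 1ℚ :+ con 0ℚ :* con 0ℚ := con 1ℚ :* t) refl
  -- for a = 1 the side from (a , 0) to (0 , n) lies on the line i/a + j/b = 1
  InRegion⇒InConv zero (suc b″) {s} {t} _ Pa0 Pn0 P0n _ (_ , 0≤t , ab≤bs+at , s+t≤n) =
    InConv-a0-n0-0n (ι (suc b″)) (ι-+ 1 (suc b″)) (ι-pos 0) (ι-pos b″) Pa0 Pn0 P0n 0≤t s+t≤n
      (subst (_≤ ι (suc (suc b″)) * s + ι 1 * t) (ι-* 1 (suc (suc b″))) ab≤bs+at)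
  InRegion⇒InConv (suc a″) b′ {s} {t} a≤b Pa0 Pn0 P0n P0b (0≤s , 0≤t , ab≤bs+at , s+t≤n)
    with ℚP.≤-total (ι (suc a″ ℕ.+ suc b′) * s + ι (suc (suc a″)) * t) (ι (suc (suc a″)) * ι (suc a″ ℕ.+ suc b′))
  ... | inj₁ ns+at≤an = InConv-a0-0n-0b (ι (suc a″)) (ι-+ (suc a″) (suc b′)) (ι-pos (suc a″)) (ι-pos a″) Pa0 P0n P0b 0≤s
                          (subst (_≤ ι (suc b′) * s + ι (suc (suc a″)) * t) (ι-* (suc (suc a″)) (suc b′)) ab≤bs+at) ns+at≤an
  ... | inj₂ an≤ns+at = InConv-a0-n0-0n (ι b′) (trans (cong ι (ℕP.+-suc (suc a″) b′)) (ι-+ (suc (suc a″)) b′))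
                          (ι-pos (suc a″)) (ℚP.<-≤-trans (ι-pos a″) (ι-mono (ℕP.≤-pred a≤b))) Pa0 Pn0 P0n 0≤t s+t≤n an≤ns+at

open NewtonPolygon using (module Vertices; InConv⇒InRegion; InRegion⇒InConv)
open import Data.Nat as ℕ using (ℕ; zero; suc; _≤_)
import Data.Nat.Properties as ℕP
open import Data.Nat.Coprimality using (Coprime)
open import Data.Rational using (ℚ)
open import Data.Product using (_×_; _,_; proj₁)

theorem3p2 : (a b : ℕ) → 1 ≤ a → a ≤ b → Coprime a b →
    (A : ℕ → ℕ → ℚ) → IsNumerator a b A →
    (s t : ℚ) → (InNewton a b A s t → InRegion a b s t) × (InRegion a b s t → InNewton a b A s t)
theorem3p2 zero _ () _ _ _ _ _ _
theorem3p2 (suc a′) zero _ () _ _ _ _ _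
theorem3p2 (suc a′) (suc b′) _ a≤b coprime A numerator s t =
  InConv⇒InRegion {a = a} {b} (λ _ _ → proj₁) above-line ,
  InRegion⇒InConv a′ b′ a≤b (Corner-a0.corner-in△ , Corner-a0.corner) (ℕP.≤-reflexive (ℕP.+-identityʳ n) , Corner-n0.corner)
                  (ℕP.≤-refl , Corner-0n.corner) (Corner-0b.corner-in△ , Corner-0b.corner)
  where
  open Vertices a′ b′ coprime A numerator
  above-line : ∀ i j → InSupport n A i j → a ℕ.* b ≤ b ℕ.* i ℕ.+ a ℕ.* j
  above-line i j (i+j≤n , Aij≢0) = ℕP.≮⇒≥ (λ below → Aij≢0 (Corner-0b.below-line i j i+j≤n below))
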